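{- Let $k$ be an odd positive integer and let $L=(X,U)$ be a finite undirected graph without loops. Then $L$ has a proper vertex coloring using at most $k$ colors if and only if at least one equivalence class of orientations of $L$ modulo $k$ contains an odd number of orientations.
   Context: An orientation of $L$ is a directed graph obtained from $L$ by choosing a direction for each edge. For an orientation $\vec L$ and a vertex $x$, let $s^+_{\vec L}(x)$ be the number of edges directed out of $x$ in $\vec L$. Two orientations $\vec L',\vec L''$ are congruent modulo $k$ if $s^+_{\vec L'}(x)\equiv s^+_{\vec L''}(x)\pmod k$ for every vertex $x$; the classes of this equivalence relation on the set of all orientations of $L$ are the equivalence classes modulo $k$. -}

module Defs where

open import Data.Nat using (ℕ; zero; suc; _+_; _%_; NonZero)
open import Data.Nat.Properties using () renaming (_≟_ to _≟ℕ_)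
open import Data.Fin using (Fin) renaming (_≟_ to _≟F_)
open import Data.Fin.Properties using (all?)
open import Data.Vec using (Vec; []; _∷_; lookup)
open import Data.List using (List; []; _∷_; [_]; map; _++_; filter; length)
open import Data.Nat.ListAction using (sum)
open import Data.List.Base using (allFin)
open import Data.Bool using (Bool; true; false; if_then_else_)
open import Data.Product using (_×_; proj₁; proj₂; ∃)
open import Relation.Binary.PropositionalEquality using (_≡_; _≢_)
open import Relation.Nullary using (Dec; yes; no)

-- A finite loopless (multi)graph on vertex set Fin n with m edges:
-- edge i joins the two distinct vertices (proj₁ (ends i)) and (proj₂ (ends i)).
record Graph (n : ℕ) : Set where
  field
    m        : ℕ
    ends     : Fin m → Fin n × Fin n
    loopless : ∀ i → proj₁ (ends i) ≢ proj₂ (ends i)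
open Graph public

-- An orientation chooses, for each edge, a direction:
-- true  : edge i is directed out of proj₁ (ends i)
-- false : edge i is directed out of proj₂ (ends i)
Orientation : ∀ {n} → Graph n → Set
Orientation L = Vec Bool (m L)

allVecs : (m : ℕ) → List (Vec Bool m)
allVecs zero    = [ [] ]
allVecs (suc m) = map (true ∷_) (allVecs m) ++ map (false ∷_) (allVecs m)

allOrientations : ∀ {n} (L : Graph n) → List (Orientation L)
allOrientations L = allVecs (m L)

tail : ∀ {n} (L : Graph n) → Orientation L → Fin (m L) → Fin n
tail L o i = if lookup o i then proj₁ (ends L i) else proj₂ (ends L i)

outdeg : ∀ {n} (L : Graph n) → Orientation L → Fin n → ℕ
outdeg L o x = sum (map (λ i → if isYes (tail L o i ≟F x) then 1 else 0) (allFin (m L)))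
  where
    isYes : ∀ {p} {P : Set p} → Dec P → Bool
    isYes (yes _) = true
    isYes (no _)  = false

Congruent : ∀ {n} (L : Graph n) (k : ℕ) .{{_ : NonZero k}} → Orientation L → Orientation L → Set
Congruent L k o o′ = ∀ x → outdeg L o x % k ≡ outdeg L o′ x % k

congruent? : ∀ {n} (L : Graph n) (k : ℕ) .{{_ : NonZero k}} (o o′ : Orientation L) → Dec (Congruent L k o o′)
congruent? L k o o′ = all? (λ x → (outdeg L o x % k) ≟ℕ (outdeg L o′ x % k))

classSize : ∀ {n} (L : Graph n) (k : ℕ) .{{_ : NonZero k}} → Orientation L → ℕ
classSize L k o = length (filter (λ o′ → congruent? L k o o′) (allOrientations L))

ProperColoring : ∀ {n} (L : Graph n) (k : ℕ) → (Fin n → Fin k) → Set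
ProperColoring L k c = ∀ i → c (proj₁ (ends L i)) ≢ c (proj₂ (ends L i))

Colorable : ∀ {n} (L : Graph n) (k : ℕ) → Set
Colorable {n} L k = ∃ λ (c : Fin n → Fin k) → ProperColoring L k c

module Submission where

-- We compute in the group algebra F₂[ℤ/k] = F₂[g]/(gᵏ - 1),
-- an element being a list of exponents a standing for Σ gᵃ.  For a colouring c and an
-- orientation o put w(c,o) = Σᵥ c(v)·s⁺(v); then
--   (1) Σ_o g^{w(c,o)} = ∏_{edges ab} (g^{c(a)} + g^{c(b)})   (graph polynomial);
--   (2) there is U ≠ 0 annihilating every orbit sum Σ_{j<k} g^{jt} with t ≢ 0 (a primitive
--       element, built prime by prime from a factorisation of k), and on U every factor
--       g^a + g^b with a ≢ b acts invertibly (a telescoping sum, using that k is odd).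
-- If c is proper, (1) and (2) give U·Σ_o g^{w(c,o)} ≠ 0; as w(c,o) mod k depends only on
-- the class of o, some class must be odd.  Conversely, for os in an odd class, summing
-- U·g^{Σᵥ c(v)(s⁺_o(v) - s⁺_os(v))} over all c and o gives U when the colourings are summed
-- first (only o congruent to os survive), but 0 when the orientations are summed first unless
-- some c is proper.

open import Defs
open import Algebra using (CommutativeRing)
open import Data.Bool using (Bool; true; false; not; _∧_; _xor_; if_then_else_)
open import Data.Bool.Properties
  using (xor-assoc; xor-comm; xor-same; xor-identityʳ; not-involutive; ¬-not; ∧-distribˡ-xor;
         ∧-zeroʳ; ∧-identityʳ; xor-∧-commutativeRing)
open import Data.Empty using (⊥-elim)
open import Data.Fin using (Fin; toℕ) renaming (zero to fzero; suc to fsuc; _≟_ to _≟F_)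
open import Data.Fin.Properties using (all?; ¬∀⟶∃¬; toℕ-injective; toℕ<n)
open import Data.List
  using (List; []; _∷_; [_]; map; _++_; concatMap; concat; length; filter; upTo; applyUpTo; tabulate; allFin)
open import Data.List.Properties
  using (length-upTo; map-++; map-∘; map-cong; map-upTo; upTo-∷ʳ; map-tabulate; ++-assoc; ++-identityʳ;
         length-filter)
open import Data.List.Membership.Propositional using (_∈_; lose)
open import Data.List.Membership.Propositional.Properties using (∈-filter⁻)
open import Data.List.Relation.Unary.All using (All; []; _∷_)
open import Data.List.Relation.Unary.Any using (here; there; any?; satisfied)
open import Data.Nat
  using (ℕ; zero; suc; _+_; _*_; _∸_; _/_; _%_; _≡ᵇ_; NonZero; _<_; _≤_; s≤s; _≟_)
open import Data.Nat.Base using (nonTrivial⇒n>1)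
open import Data.Nat.Coprimality using (Coprime; coprime-Bézout)
open import Data.Nat.DivMod
  using (%-distribˡ-+; %-distribˡ-*; m%n%n≡m%n; m%n<n; n%n≡0; n%1≡0; [m+n]%n≡m%n; [m+kn]%n≡m%n;
         m*n%n≡0; m≡m%n+[m/n]*n; m<n⇒m%n≡m; m/n*n≡m; m*[n/m]≡n; m/n≡0⇒m<n; m/n<m; m*n/n≡m;
         m%n*o≡m*o%[n*o]; m∣n⇒o%n%m≡o%m; m%[n*o]/o≡m/o%n)
open import Data.Nat.Divisibility using (divides; ∣⇒≤; m%n≡0⇒n∣m; n∣m⇒m%n≡0)
open import Data.Nat.GCD using (module Bézout)
import Data.Nat.ListAction as ListAction
open ListAction using (product)
open import Data.Nat.Primality using (Prime; prime⇒irreducible; prime⇒nonTrivial; prime⇒nonZero; productOfPrimes≢0)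
open import Data.Nat.Primality.Factorisation using (PrimeFactorisation; factorise)
open import Data.Nat.Properties
  using (+-comm; +-assoc; +-suc; +-identityʳ; *-comm; *-assoc; *-suc; *-zeroʳ; *-identityʳ; *-distribʳ-+;
         *-distribˡ-+; m∸n+n≡m; m+[n∸m]≡n; <⇒≤; <⇒≱; 0≢1+n; m*n≢0; ≤-refl; ≤-trans; +-*-semiring)
open import Data.Nat.Tactic.RingSolver using (solve-∀)
open import Data.Product using (Σ; _×_; _,_; proj₁; proj₂; ∃)
open import Data.Sum using (inj₁; inj₂)
open import Data.Vec using (Vec; lookup) renaming (_∷_ to _∷ᵥ_)
open import Data.Vec.Functional using () renaming ([] to []ᶠ; _∷_ to _∷ᶠ_)
open import Function using (_∘_; id)
open import Function.Bundles using (_⇔_; mk⇔)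
open import Level using (0ℓ)
open import Relation.Binary.Bundles using (Setoid)
open import Relation.Binary.Core using (Rel)
open import Relation.Binary.Definitions using (Decidable)
open import Relation.Binary.Structures using (IsEquivalence)
open import Relation.Binary.PropositionalEquality
  using (_≡_; _≢_; refl; sym; trans; cong; cong₂; subst; module ≡-Reasoning)
import Relation.Binary.Reasoning.Setoid as ≈-Reasoning
open import Relation.Nullary using (¬_; Dec; yes; no; does; ¬?; contradiction)
open import Relation.Nullary.Decidable using (decidable-stable)
import Relation.Unary as U
open import Algebra.Properties.Semiring.Sum +-*-semiring
  using (sum; sum-syntax; ∑-comm; ∑-distrib-+; *-distribˡ-sum; sum-cong-≗; sum-replicate-zero)

open import Algebra.Properties.CommutativeSemigroup
  (CommutativeRing.+-commutativeSemigroup xor-∧-commutativeRing)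
  using () renaming (interchange to xor-interchange)

private
  variable
    A B : Set

parity : (A → Bool) → List A → Bool
parity f []       = false
parity f (x ∷ xs) = f x xor parity f xs

parity-++ : (f : A → Bool) (xs ys : List A) → parity f (xs ++ ys) ≡ parity f xs xor parity f ys
parity-++ f []       ys = refl
parity-++ f (x ∷ xs) ys =
  trans (cong (f x xor_) (parity-++ f xs ys)) (sym (xor-assoc (f x) (parity f xs) (parity f ys)))

parity-map : (f : B → Bool) (g : A → B) (xs : List A) → parity f (map g xs) ≡ parity (f ∘ g) xs
parity-map f g []       = refl
parity-map f g (x ∷ xs) = cong (f (g x) xor_) (parity-map f g xs)

parity-concatMap : (f : B → Bool) (g : A → List B) (xs : List A) →
  parity f (concatMap g xs) ≡ parity (λ x → parity f (g x)) xs
parity-concatMap f g []       = refl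
parity-concatMap f g (x ∷ xs) =
  trans (parity-++ f (g x) (concat (map g xs))) (cong (parity f (g x) xor_) (parity-concatMap f g xs))

parity-cong : {f g : A → Bool} → (∀ x → f x ≡ g x) → (xs : List A) → parity f xs ≡ parity g xs
parity-cong f≡g []       = refl
parity-cong f≡g (x ∷ xs) = cong₂ _xor_ (f≡g x) (parity-cong f≡g xs)

parity-false : (xs : List A) → parity (λ _ → false) xs ≡ false
parity-false []       = refl
parity-false (x ∷ xs) = parity-false xs

parity-xor : (f g : A → Bool) (xs : List A) →
  parity (λ x → f x xor g x) xs ≡ parity f xs xor parity g xs
parity-xor f g []       = refl
parity-xor f g (x ∷ xs) =
  trans (cong ((f x xor g x) xor_) (parity-xor f g xs)) (xor-interchange (f x) (g x) (parity f xs) (parity g xs))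

parity-∧ : (b : Bool) (f : A → Bool) (xs : List A) → parity (λ x → b ∧ f x) xs ≡ b ∧ parity f xs
parity-∧ b f []       = sym (∧-zeroʳ b)
parity-∧ b f (x ∷ xs) =
  trans (cong ((b ∧ f x) xor_) (parity-∧ b f xs)) (sym (∧-distribˡ-xor b (f x) (parity f xs)))

parity-swap : (h : A → B → Bool) (xs : List A) (ys : List B) →
  parity (λ x → parity (h x) ys) xs ≡ parity (λ y → parity (λ x → h x y) xs) ys
parity-swap h []       ys = sym (parity-false ys)
parity-swap h (x ∷ xs) ys =
  trans (cong (parity (h x) ys xor_) (parity-swap h xs ys))
        (sym (parity-xor (h x) (λ y → parity (λ x → h x y) xs) ys))

isOdd : ℕ → Bool
isOdd zero    = false
isOdd (suc n) = not (isOdd n)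

xor-∧-not : ∀ b c → b xor (b ∧ c) ≡ b ∧ not c
xor-∧-not false c     = refl
xor-∧-not true  false = refl
xor-∧-not true  true  = refl

parity-const : (b : Bool) (xs : List A) → parity (λ _ → b) xs ≡ b ∧ isOdd (length xs)
parity-const b []       = sym (∧-zeroʳ b)
parity-const b (x ∷ xs) = trans (cong (b xor_) (parity-const b xs)) (xor-∧-not b (isOdd (length xs)))

isOdd-filter : {P : A → Set} (P? : U.Decidable P) (xs : List A) →
  isOdd (length (filter P? xs)) ≡ parity (does ∘ P?) xs
isOdd-filter P? []       = refl
isOdd-filter P? (x ∷ xs) with does (P? x)
... | true  = cong not (isOdd-filter P? xs)
... | false = isOdd-filter P? xs

private
  %2-suc-suc : ∀ n → suc (suc n) % 2 ≡ n % 2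
  %2-suc-suc n = trans (cong (_% 2) (+-comm 2 n)) ([m+n]%n≡m%n n 2)

isOdd-complete : ∀ n → n % 2 ≡ 1 → isOdd n ≡ true
isOdd-complete (suc zero)    _     = refl
isOdd-complete (suc (suc n)) n-odd =
  trans (not-involutive (isOdd n)) (isOdd-complete n (trans (sym (%2-suc-suc n)) n-odd))

isOdd-sound : ∀ n → isOdd n ≡ true → n % 2 ≡ 1
isOdd-sound (suc zero)    _     = refl
isOdd-sound (suc (suc n)) n-odd =
  trans (%2-suc-suc n) (isOdd-sound n (trans (sym (not-involutive (isOdd n))) n-odd))

isOdd-false : ∀ n → n % 2 ≢ 1 → isOdd n ≡ false
isOdd-false n n-even = ¬-not (λ n-odd → n-even (isOdd-sound n n-odd))

-- A list of exponents xs represents the element Σ_{a ∈ xs} gᵃ of the group algebra of a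
-- cyclic group ⟨g⟩ over the two-element field.  Sum is concatenation, 𝟘 = [], 𝟙 = [ 0 ],
-- and the product is the convolution below; the order of the group enters only through
-- the equality _≈_ of the module GroupAlgebra.
infixl 7 _⊗_
_⊗_ : List ℕ → List ℕ → List ℕ
xs ⊗ ys = concatMap (λ a → map (a +_) ys) xs

𝟙 : List ℕ
𝟙 = [ 0 ]

∏ : (n : ℕ) → (Fin n → List ℕ) → List ℕ
∏ zero    f = 𝟙
∏ (suc n) f = f fzero ⊗ ∏ n (f ∘ fsuc)

parity-⊗ : (P : ℕ → Bool) (xs ys : List ℕ) →
  parity P (xs ⊗ ys) ≡ parity (λ a → parity (λ b → P (a + b)) ys) xs
parity-⊗ P xs ys =
  trans (parity-concatMap P (λ a → map (a +_) ys) xs) (parity-cong (λ a → parity-map P (a +_) ys) xs)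

module Modular (k : ℕ) .{{_ : NonZero k}} where

  +-cong-mod : ∀ {a a′ b b′} → a % k ≡ a′ % k → b % k ≡ b′ % k → (a + b) % k ≡ (a′ + b′) % k
  +-cong-mod {a} {a′} {b} {b′} a≡a′ b≡b′ =
    trans (%-distribˡ-+ a b k) (trans (cong₂ (λ x y → (x + y) % k) a≡a′ b≡b′) (sym (%-distribˡ-+ a′ b′ k)))

  *-congˡ-mod : ∀ a {b b′} → b % k ≡ b′ % k → (a * b) % k ≡ (a * b′) % k
  *-congˡ-mod a {b} {b′} b≡b′ =
    trans (%-distribˡ-* a b k) (trans (cong (λ z → (a % k * z) % k) b≡b′) (sym (%-distribˡ-* a b′ k)))

  -- x ⊖ y represents the residue x - y
  _⊖_ : ℕ → ℕ → ℕ
  x ⊖ y = x + (k ∸ y % k)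

  ⊖-add : ∀ x y → ((x ⊖ y) + y) % k ≡ x % k
  ⊖-add x y = begin
    (x + (k ∸ y % k) + y) % k        ≡⟨ +-cong-mod {x + (k ∸ y % k)} refl (sym (m%n%n≡m%n y k)) ⟩
    (x + (k ∸ y % k) + y % k) % k    ≡⟨ cong (_% k) (+-assoc x _ (y % k)) ⟩
    (x + ((k ∸ y % k) + y % k)) % k  ≡⟨ cong (λ z → (x + z) % k) (m∸n+n≡m (<⇒≤ (m%n<n y k))) ⟩
    (x + k) % k                      ≡⟨ [m+n]%n≡m%n x k ⟩
    x % k                            ∎
    where open ≡-Reasoning

  ⊖-self : ∀ y → (y ⊖ y) % k ≡ 0
  ⊖-self y = begin
    (y + (k ∸ y % k)) % k      ≡⟨ +-cong-mod {y} (sym (m%n%n≡m%n y k)) refl ⟩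
    (y % k + (k ∸ y % k)) % k  ≡⟨ cong (_% k) (m+[n∸m]≡n (<⇒≤ (m%n<n y k))) ⟩
    k % k                      ≡⟨ n%n≡0 k ⟩
    0                          ∎
    where open ≡-Reasoning

  ⊖≡0⇒≡ : ∀ x y → (x ⊖ y) % k ≡ 0 → x % k ≡ y % k
  ⊖≡0⇒≡ x y x⊖y≡0 = begin
    x % k                 ≡⟨ ⊖-add x y ⟨
    ((x ⊖ y) + y) % k     ≡⟨ +-cong-mod {x ⊖ y} (trans x⊖y≡0 (sym (n%n≡0 k))) refl ⟩
    (k + y) % k           ≡⟨ cong (_% k) (+-comm k y) ⟩
    (y + k) % k           ≡⟨ [m+n]%n≡m%n y k ⟩
    y % k                 ∎
    where open ≡-Reasoning

  ≡⇒⊖≡0 : ∀ x y → x % k ≡ y % k → (x ⊖ y) % k ≡ 0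
  ≡⇒⊖≡0 x y x≡y = trans (+-cong-mod {x} x≡y refl) (⊖-self y)

-- Two formal sums are equal when every k-periodic predicate
-- has the same parity on them: this says exactly that every residue class mod k occurs
-- with the same parity, without having to enumerate residues.
module GroupAlgebra (k : ℕ) .{{_ : NonZero k}} where
  open Modular k

  Periodic : (ℕ → Bool) → Set
  Periodic P = ∀ e → P e ≡ P (e % k)

  infix 4 _≈_
  record _≈_ (xs ys : List ℕ) : Set where
    constructor by-parity
    field test : ∀ P → Periodic P → parity P xs ≡ parity P ys
  open _≈_ public

  ≈-isEquivalence : IsEquivalence _≈_
  ≈-isEquivalence = record
    { refl  = by-parity λ _ _ → refl
    ; sym   = λ e → by-parity λ P per → sym (test e P per)
    ; trans = λ e f → by-parity λ P per → trans (test e P per) (test f P per)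
    }

  setoid : Setoid _ _
  setoid = record { isEquivalence = ≈-isEquivalence }

  open IsEquivalence ≈-isEquivalence public
    using () renaming (refl to ≈-refl; sym to ≈-sym; trans to ≈-trans; reflexive to ≡⇒≈)

  periodic-shift : ∀ {P} → Periodic P → ∀ a → Periodic (λ b → P (a + b))
  periodic-shift {P} per a b =
    trans (per (a + b)) (trans (cong P (+-cong-mod {a} refl (sym (m%n%n≡m%n b k)))) (sym (per (a + b % k))))

  single-cong : ∀ {a b} → a % k ≡ b % k → [ a ] ≈ [ b ]
  single-cong {a} {b} a≡b = by-parity λ P per →
    cong (_xor false) (trans (per a) (trans (cong P a≡b) (sym (per b))))

  ++-cong : ∀ {x x′ y y′} → x ≈ x′ → y ≈ y′ → x ++ y ≈ x′ ++ y′
  ++-cong {x} {x′} {y} {y′} e f = by-parity λ P per →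
    trans (parity-++ P x y) (trans (cong₂ _xor_ (test e P per) (test f P per)) (sym (parity-++ P x′ y′)))

  ++-comm : ∀ x y → x ++ y ≈ y ++ x
  ++-comm x y = by-parity λ P _ →
    trans (parity-++ P x y) (trans (xor-comm (parity P x) (parity P y)) (sym (parity-++ P y x)))

  ++-self : ∀ x → x ++ x ≈ []
  ++-self x = by-parity λ P _ → trans (parity-++ P x x) (xor-same (parity P x))

  ⊗-congʳ : ∀ x {y y′} → y ≈ y′ → x ⊗ y ≈ x ⊗ y′
  ⊗-congʳ x {y} {y′} e = by-parity λ P per →
    trans (parity-⊗ P x y)
      (trans (parity-cong (λ a → test e (λ b → P (a + b)) (periodic-shift per a)) x) (sym (parity-⊗ P x y′)))

  ⊗-comm : ∀ x y → x ⊗ y ≈ y ⊗ x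
  ⊗-comm x y = by-parity λ P _ → begin
    parity P (x ⊗ y)                                       ≡⟨ parity-⊗ P x y ⟩
    parity (λ a → parity (λ b → P (a + b)) y) x            ≡⟨ parity-swap (λ a b → P (a + b)) x y ⟩
    parity (λ b → parity (λ a → P (a + b)) x) y            ≡⟨ parity-cong (λ b → parity-cong (λ a → cong P (+-comm a b)) x) y ⟩
    parity (λ b → parity (λ a → P (b + a)) x) y            ≡⟨ parity-⊗ P y x ⟨
    parity P (y ⊗ x)                                       ∎
    where open ≡-Reasoning

  ⊗-congˡ : ∀ {x x′} y → x ≈ x′ → x ⊗ y ≈ x′ ⊗ y
  ⊗-congˡ {x} {x′} y e = ≈-trans (⊗-comm x y) (≈-trans (⊗-congʳ y e) (⊗-comm y x′))

  ⊗-cong : ∀ {x x′ y y′} → x ≈ x′ → y ≈ y′ → x ⊗ y ≈ x′ ⊗ y′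
  ⊗-cong {x′ = x′} {y} e f = ≈-trans (⊗-congˡ y e) (⊗-congʳ x′ f)

  ⊗-assoc : ∀ x y z → (x ⊗ y) ⊗ z ≈ x ⊗ (y ⊗ z)
  ⊗-assoc x y z = by-parity λ P _ → begin
    parity P ((x ⊗ y) ⊗ z)
      ≡⟨ parity-⊗ P (x ⊗ y) z ⟩
    parity (λ ab → parity (λ c → P (ab + c)) z) (x ⊗ y)
      ≡⟨ parity-⊗ (λ ab → parity (λ c → P (ab + c)) z) x y ⟩
    parity (λ a → parity (λ b → parity (λ c → P (a + b + c)) z) y) x
      ≡⟨ parity-cong (λ a → parity-cong (λ b → parity-cong (λ c → cong P (+-assoc a b c)) z) y) x ⟩
    parity (λ a → parity (λ b → parity (λ c → P (a + (b + c))) z) y) x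
      ≡⟨ parity-cong (λ a → parity-⊗ (λ bc → P (a + bc)) y z) x ⟨
    parity (λ a → parity (λ bc → P (a + bc)) (y ⊗ z)) x
      ≡⟨ parity-⊗ P x (y ⊗ z) ⟨
    parity P (x ⊗ (y ⊗ z))
      ∎
    where open ≡-Reasoning

  ⊗-distribʳ : ∀ x x′ y → (x ++ x′) ⊗ y ≈ x ⊗ y ++ x′ ⊗ y
  ⊗-distribʳ x x′ y = by-parity λ P _ →
    trans (parity-⊗ P (x ++ x′) y)
      (trans (parity-++ _ x x′)
        (trans (cong₂ _xor_ (sym (parity-⊗ P x y)) (sym (parity-⊗ P x′ y))) (sym (parity-++ P (x ⊗ y) (x′ ⊗ y)))))

  ⊗-distribˡ : ∀ x y y′ → x ⊗ (y ++ y′) ≈ x ⊗ y ++ x ⊗ y′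
  ⊗-distribˡ x y y′ =
    ≈-trans (⊗-comm x (y ++ y′)) (≈-trans (⊗-distribʳ y y′ x) (++-cong (⊗-comm y x) (⊗-comm y′ x)))

  ⊗-zeroʳ : ∀ x → x ⊗ [] ≈ []
  ⊗-zeroʳ x = by-parity λ P _ → trans (parity-⊗ P x []) (parity-false x)

  ⊗-identityˡ : ∀ x → 𝟙 ⊗ x ≈ x
  ⊗-identityˡ x = by-parity λ P _ → trans (parity-⊗ P 𝟙 x) (xor-identityʳ _)

  ⊗-identityʳ : ∀ x → x ⊗ 𝟙 ≈ x
  ⊗-identityʳ x = ≈-trans (⊗-comm x 𝟙) (⊗-identityˡ x)

  concatMap-cong : {f g : A → List ℕ} (xs : List A) → (∀ x → f x ≈ g x) → concatMap f xs ≈ concatMap g xs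
  concatMap-cong {f = f} {g} xs f≈g = by-parity λ P per →
    trans (parity-concatMap P f xs)
      (trans (parity-cong (λ x → test (f≈g x) P per) xs) (sym (parity-concatMap P g xs)))

  ⊗-distrib-concatMap : (u : List ℕ) (f : A → List ℕ) (xs : List A) →
    u ⊗ concatMap f xs ≈ concatMap (λ x → u ⊗ f x) xs
  ⊗-distrib-concatMap u f []       = ⊗-zeroʳ u
  ⊗-distrib-concatMap u f (x ∷ xs) =
    ≈-trans (⊗-distribˡ u (f x) (concatMap f xs)) (++-cong ≈-refl (⊗-distrib-concatMap u f xs))

  concatMap-swap : (f : A → B → List ℕ) (xs : List A) (ys : List B) →
    concatMap (λ x → concatMap (f x) ys) xs ≈ concatMap (λ y → concatMap (λ x → f x y) xs) ys
  concatMap-swap f xs ys = by-parity λ P _ → begin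
    parity P (concatMap (λ x → concatMap (f x) ys) xs)
      ≡⟨ parity-concatMap P _ xs ⟩
    parity (λ x → parity P (concatMap (f x) ys)) xs
      ≡⟨ parity-cong (λ x → parity-concatMap P (f x) ys) xs ⟩
    parity (λ x → parity (λ y → parity P (f x y)) ys) xs
      ≡⟨ parity-swap (λ x y → parity P (f x y)) xs ys ⟩
    parity (λ y → parity (λ x → parity P (f x y)) xs) ys
      ≡⟨ parity-cong (λ y → parity-concatMap P (λ x → f x y) xs) ys ⟨
    parity (λ y → parity P (concatMap (λ x → f x y) xs)) ys
      ≡⟨ parity-concatMap P _ ys ⟨
    parity P (concatMap (λ y → concatMap (λ x → f x y) xs) ys)
      ∎
    where open ≡-Reasoning

  concatMap-if : (b : A → Bool) (u : List ℕ) (xs : List A) →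
    concatMap (λ x → if b x then u else []) xs ≈ (if parity b xs then u else [])
  concatMap-if b u xs = by-parity λ P _ → begin
    parity P (concatMap (λ x → if b x then u else []) xs)  ≡⟨ parity-concatMap P _ xs ⟩
    parity (λ x → parity P (if b x then u else [])) xs      ≡⟨ parity-cong (λ x → parity-if P (b x)) xs ⟩
    parity (λ x → parity P u ∧ b x) xs                      ≡⟨ parity-∧ (parity P u) b xs ⟩
    parity P u ∧ parity b xs                                ≡⟨ parity-if P (parity b xs) ⟨
    parity P (if parity b xs then u else [])                ∎
    where
    open ≡-Reasoning
    parity-if : ∀ P c → parity P (if c then u else []) ≡ parity P u ∧ c
    parity-if P true  = sym (∧-identityʳ _)
    parity-if P false = sym (∧-zeroʳ _)

  map-as-concatMap : (g : A → ℕ) (xs : List A) → map g xs ≈ concatMap (λ x → [ g x ]) xs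
  map-as-concatMap g xs = ≡⇒≈ (as-singletons xs)
    where
    as-singletons : ∀ xs → map g xs ≡ concatMap (λ x → [ g x ]) xs
    as-singletons []       = refl
    as-singletons (x ∷ xs) = cong (g x ∷_) (as-singletons xs)

  concatMap-vanishes : {f : A → List ℕ} (xs : List A) → (∀ x → x ∈ xs → f x ≈ []) → concatMap f xs ≈ []
  concatMap-vanishes []       _         = ≈-refl
  concatMap-vanishes (x ∷ xs) vanishes =
    ++-cong (vanishes x (here refl)) (concatMap-vanishes xs (λ y y∈xs → vanishes y (there y∈xs)))

  ∏-ones : ∀ n (f : Fin n → List ℕ) → (∀ i → f i ≈ 𝟙) → ∏ n f ≈ 𝟙
  ∏-ones zero    f f≈𝟙 = ≈-refl
  ∏-ones (suc n) f f≈𝟙 = ≈-trans (⊗-cong (f≈𝟙 fzero) (∏-ones n (f ∘ fsuc) (f≈𝟙 ∘ fsuc))) (⊗-identityˡ 𝟙)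

  ∏-factor : ∀ n (f : Fin n → List ℕ) i → Σ (List ℕ) λ r → ∏ n f ≈ f i ⊗ r
  ∏-factor (suc n) f fzero    = ∏ n (f ∘ fsuc) , ≈-refl
  ∏-factor (suc n) f (fsuc i) with ∏-factor n (f ∘ fsuc) i
  ... | r , ∏≈ = f fzero ⊗ r , (begin
    f fzero ⊗ ∏ n (f ∘ fsuc)   ≈⟨ ⊗-congʳ (f fzero) ∏≈ ⟩
    f fzero ⊗ (f (fsuc i) ⊗ r) ≈⟨ ⊗-assoc (f fzero) (f (fsuc i)) r ⟨
    f fzero ⊗ f (fsuc i) ⊗ r   ≈⟨ ⊗-congˡ r (⊗-comm (f fzero) (f (fsuc i))) ⟩
    f (fsuc i) ⊗ f fzero ⊗ r   ≈⟨ ⊗-assoc (f (fsuc i)) (f fzero) r ⟩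
    f (fsuc i) ⊗ (f fzero ⊗ r) ∎)
    where open ≈-Reasoning setoid

  ∏-absorb : ∀ u n (f : Fin n → List ℕ) i → u ⊗ f i ≈ [] → u ⊗ ∏ n f ≈ []
  ∏-absorb u n f i uf≈0 with ∏-factor n f i
  ... | r , ∏≈ = begin
    u ⊗ ∏ n f     ≈⟨ ⊗-congʳ u ∏≈ ⟩
    u ⊗ (f i ⊗ r) ≈⟨ ⊗-assoc u (f i) r ⟨
    u ⊗ f i ⊗ r   ≈⟨ ⊗-congˡ r uf≈0 ⟩
    [] ⊗ r        ≈⟨ ≈-refl ⟩
    []            ∎
    where open ≈-Reasoning setoid

  ∏-zero : ∀ n (f : Fin n → List ℕ) i → f i ≈ [] → ∏ n f ≈ []
  ∏-zero n f i fi≈0 =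
    ≈-trans (≈-sym (⊗-identityˡ (∏ n f))) (∏-absorb 𝟙 n f i (≈-trans (⊗-identityˡ (f i)) fi≈0))

  ∏-fix : ∀ u n (f : Fin n → List ℕ) → (∀ i → u ⊗ f i ≈ u) → u ⊗ ∏ n f ≈ u
  ∏-fix u zero    f fix = ⊗-identityʳ u
  ∏-fix u (suc n) f fix =
    ≈-trans (≈-sym (⊗-assoc u (f fzero) _)) (≈-trans (⊗-congˡ _ (fix fzero)) (∏-fix u n (f ∘ fsuc) (fix ∘ fsuc)))

  ∏-⊗ : ∀ n (f g : Fin n → List ℕ) → ∏ n f ⊗ ∏ n g ≈ ∏ n (λ i → f i ⊗ g i)
  ∏-⊗ zero    f g = ⊗-identityˡ 𝟙
  ∏-⊗ (suc n) f g = begin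
    f fzero ⊗ F ⊗ (g fzero ⊗ G)   ≈⟨ ⊗-assoc (f fzero) F (g fzero ⊗ G) ⟩
    f fzero ⊗ (F ⊗ (g fzero ⊗ G)) ≈⟨ ⊗-congʳ (f fzero) (⊗-assoc F (g fzero) G) ⟨
    f fzero ⊗ (F ⊗ g fzero ⊗ G)   ≈⟨ ⊗-congʳ (f fzero) (⊗-congˡ G (⊗-comm F (g fzero))) ⟩
    f fzero ⊗ (g fzero ⊗ F ⊗ G)   ≈⟨ ⊗-congʳ (f fzero) (⊗-assoc (g fzero) F G) ⟩
    f fzero ⊗ (g fzero ⊗ (F ⊗ G)) ≈⟨ ⊗-assoc (f fzero) (g fzero) (F ⊗ G) ⟨
    f fzero ⊗ g fzero ⊗ (F ⊗ G)   ≈⟨ ⊗-congʳ (f fzero ⊗ g fzero) (∏-⊗ n (f ∘ fsuc) (g ∘ fsuc)) ⟩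
    f fzero ⊗ g fzero ⊗ ∏ n (λ i → f (fsuc i) ⊗ g (fsuc i)) ∎
    where
    open ≈-Reasoning setoid
    F G : List ℕ
    F = ∏ n (f ∘ fsuc)
    G = ∏ n (g ∘ fsuc)

  annihilate-via : ∀ u y z → y ⊗ z ≈ y → u ⊗ z ≈ [] → u ⊗ y ≈ []
  annihilate-via u y z yz≈y uz≈0 = begin
    u ⊗ y         ≈⟨ ⊗-congʳ u yz≈y ⟨
    u ⊗ (y ⊗ z)   ≈⟨ ⊗-congʳ u (⊗-comm y z) ⟩
    u ⊗ (z ⊗ y)   ≈⟨ ⊗-assoc u z y ⟨
    u ⊗ z ⊗ y     ≈⟨ ⊗-congˡ y uz≈0 ⟩
    [] ⊗ y        ≈⟨ ≈-refl ⟩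
    []            ∎
    where open ≈-Reasoning setoid

upTo-suc : ∀ n → upTo (suc n) ≡ 0 ∷ map suc (upTo n)
upTo-suc n = cong (0 ∷_) (sym (map-upTo suc n))

upTo-+ : ∀ a b → upTo (a + b) ≡ upTo a ++ map (a +_) (upTo b)
upTo-+ zero    b = sym (map-upTo id b)
upTo-+ (suc a) b = begin
  upTo (suc a + b)                                      ≡⟨ upTo-suc (a + b) ⟩
  0 ∷ map suc (upTo (a + b))                            ≡⟨ cong (λ xs → 0 ∷ map suc xs) (upTo-+ a b) ⟩
  0 ∷ map suc (upTo a ++ map (a +_) (upTo b))           ≡⟨ cong (0 ∷_) (map-++ suc (upTo a) _) ⟩
  0 ∷ (map suc (upTo a) ++ map suc (map (a +_) (upTo b))) ≡⟨ cong (λ xs → 0 ∷ (map suc (upTo a) ++ xs)) (map-∘ (upTo b)) ⟨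
  0 ∷ (map suc (upTo a) ++ map (suc a +_) (upTo b))     ≡⟨ cong (_++ map (suc a +_) (upTo b)) (upTo-suc a) ⟨
  upTo (suc a) ++ map (suc a +_) (upTo b)               ∎
  where open ≡-Reasoning

allFin-upTo : ∀ n → map toℕ (allFin n) ≡ upTo n
allFin-upTo n = trans (map-tabulate id toℕ) (tabulate-toℕ n id)
  where
  tabulate-toℕ : ∀ n (f : ℕ → ℕ) → tabulate {n = n} (f ∘ toℕ) ≡ applyUpTo f n
  tabulate-toℕ zero    f = refl
  tabulate-toℕ (suc n) f = cong (f 0 ∷_) (tabulate-toℕ n (f ∘ suc))

parity-upTo-suc : ∀ (Q : ℕ → Bool) n → parity Q (upTo (suc n)) ≡ Q 0 xor parity (Q ∘ suc) (upTo n)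
parity-upTo-suc Q n = trans (cong (parity Q) (upTo-suc n)) (cong (Q 0 xor_) (parity-map Q suc (upTo n)))

parity-upTo-snoc : ∀ (Q : ℕ → Bool) n → parity Q (upTo (suc n)) ≡ parity Q (upTo n) xor Q n
parity-upTo-snoc Q n = begin
  parity Q (upTo (suc n))              ≡⟨ cong (parity Q) (upTo-∷ʳ n) ⟨
  parity Q (upTo n ++ [ n ])           ≡⟨ parity-++ Q (upTo n) [ n ] ⟩
  parity Q (upTo n) xor (Q n xor false) ≡⟨ cong (parity Q (upTo n) xor_) (xor-identityʳ (Q n)) ⟩
  parity Q (upTo n) xor Q n            ∎
  where open ≡-Reasoning

parity-translate : ∀ (Q : ℕ → Bool) k → (∀ e → Q (e + k) ≡ Q e) →
  ∀ c → parity (λ j → Q (c + j)) (upTo k) ≡ parity Q (upTo k)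
parity-translate Q k periodic zero    = refl
parity-translate Q k periodic (suc c) =
  trans (parity-cong (λ j → cong Q (sym (+-suc c j))) (upTo k))
    (trans (rotate (λ j → Q (c + j)) k (trans (periodic c) (cong Q (sym (+-identityʳ c)))))
      (parity-translate Q k periodic c))
  where
  rotate : ∀ (R : ℕ → Bool) k → R k ≡ R 0 → parity (R ∘ suc) (upTo k) ≡ parity R (upTo k)
  rotate R zero    _       = refl
  rotate R (suc k) Rk≡R0 = begin
    parity (R ∘ suc) (upTo (suc k))        ≡⟨ parity-upTo-snoc (R ∘ suc) k ⟩
    parity (R ∘ suc) (upTo k) xor R (suc k) ≡⟨ cong (parity (R ∘ suc) (upTo k) xor_) Rk≡R0 ⟩
    parity (R ∘ suc) (upTo k) xor R 0       ≡⟨ xor-comm _ (R 0) ⟩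
    R 0 xor parity (R ∘ suc) (upTo k)       ≡⟨ parity-upTo-suc R k ⟨
    parity R (upTo (suc k))                ∎
    where open ≡-Reasoning

parity-repeat : ∀ (Q : ℕ → Bool) a → (∀ j → Q (a + j) ≡ Q j) →
  ∀ q → parity Q (upTo (q * a)) ≡ parity Q (upTo a) ∧ isOdd q
parity-repeat Q a periodic zero    = sym (∧-zeroʳ (parity Q (upTo a)))
parity-repeat Q a periodic (suc q) = begin
  parity Q (upTo (a + q * a))
    ≡⟨ cong (parity Q) (upTo-+ a (q * a)) ⟩
  parity Q (upTo a ++ map (a +_) (upTo (q * a)))
    ≡⟨ parity-++ Q (upTo a) _ ⟩
  parity Q (upTo a) xor parity Q (map (a +_) (upTo (q * a)))
    ≡⟨ cong (parity Q (upTo a) xor_) (trans (parity-map Q (a +_) (upTo (q * a))) (parity-cong periodic (upTo (q * a)))) ⟩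
  parity Q (upTo a) xor parity Q (upTo (q * a))
    ≡⟨ cong (parity Q (upTo a) xor_) (parity-repeat Q a periodic q) ⟩
  parity Q (upTo a) xor (parity Q (upTo a) ∧ isOdd q)
    ≡⟨ xor-∧-not (parity Q (upTo a)) (isOdd q) ⟩
  parity Q (upTo a) ∧ not (isOdd q)
    ∎
  where open ≡-Reasoning

-- multiples k t = 1 + gᵗ + g²ᵗ + ⋯ + g⁽ᵏ⁻¹⁾ᵗ, the sum over the orbit of gᵗ traversed k times
multiples : ℕ → ℕ → List ℕ
multiples k t = map (_* t) (upTo k)

oddMultiples : ℕ → ℕ → List ℕ
oddMultiples h d = map (λ i → suc (2 * i) * d) (upTo h)

parity-multiples : ∀ P k t → parity P (multiples k t) ≡ parity (λ j → P (j * t)) (upTo k)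
parity-multiples P k t = parity-map P (_* t) (upTo k)

parity-oddMultiples : ∀ (P : ℕ → Bool) d h →
  parity P (oddMultiples h d) xor parity (λ b → P (d + b)) (oddMultiples h d)
    ≡ parity (λ j → P (suc j * d)) (upTo (2 * h))
parity-oddMultiples P d zero    = refl
parity-oddMultiples P d (suc h) = begin
  parity P (oddMultiples (suc h) d) xor parity P′ (oddMultiples (suc h) d)
    ≡⟨ cong (λ xs → parity P xs xor parity P′ xs) oddMultiples-snoc ⟩
  parity P (W ++ [ x ]) xor parity P′ (W ++ [ x ])
    ≡⟨ cong₂ _xor_ (parity-snoc P W x) (parity-snoc P′ W x) ⟩
  (parity P W xor P x) xor (parity P′ W xor P′ x)
    ≡⟨ xor-interchange (parity P W) (P x) (parity P′ W) (P′ x) ⟩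
  (parity P W xor parity P′ W) xor (P x xor P′ x)
    ≡⟨ cong (_xor (P x xor P′ x)) (parity-oddMultiples P d h) ⟩
  parity Q (upTo (2 * h)) xor (Q (2 * h) xor Q (suc (2 * h)))
    ≡⟨ xor-assoc (parity Q (upTo (2 * h))) (Q (2 * h)) (Q (suc (2 * h))) ⟨
  (parity Q (upTo (2 * h)) xor Q (2 * h)) xor Q (suc (2 * h))
    ≡⟨ cong (_xor Q (suc (2 * h))) (parity-upTo-snoc Q (2 * h)) ⟨
  parity Q (upTo (suc (2 * h))) xor Q (suc (2 * h))
    ≡⟨ parity-upTo-snoc Q (suc (2 * h)) ⟨
  parity Q (upTo (suc (suc (2 * h))))
    ≡⟨ cong (parity Q ∘ upTo) (*-suc 2 h) ⟨
  parity Q (upTo (2 * suc h))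
    ∎
  where
  open ≡-Reasoning
  P′ Q : ℕ → Bool
  P′ b = P (d + b)
  Q j  = P (suc j * d)
  W : List ℕ
  W = oddMultiples h d
  x : ℕ
  x = suc (2 * h) * d
  oddMultiples-snoc : oddMultiples (suc h) d ≡ W ++ [ x ]
  oddMultiples-snoc =
    trans (cong (map (λ i → suc (2 * i) * d)) (sym (upTo-∷ʳ h))) (map-++ _ (upTo h) [ h ])
  parity-snoc : ∀ R xs y → parity R (xs ++ [ y ]) ≡ parity R xs xor R y
  parity-snoc R xs y = trans (parity-++ R xs [ y ]) (cong (parity R xs xor_) (xor-identityʳ (R y)))

module OddModulus (k : ℕ) .{{_ : NonZero k}} (k-odd : k % 2 ≡ 1) where
  open GroupAlgebra k
  open Modular k

  parity-period-const : ∀ b → parity (λ _ → b) (upTo k) ≡ b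
  parity-period-const b = begin
    parity (λ _ → b) (upTo k)       ≡⟨ parity-const b (upTo k) ⟩
    b ∧ isOdd (length (upTo k))     ≡⟨ cong (λ n → b ∧ isOdd n) (length-upTo k) ⟩
    b ∧ isOdd k                     ≡⟨ cong (b ∧_) (isOdd-complete k k-odd) ⟩
    b ∧ true                        ≡⟨ ∧-identityʳ b ⟩
    b                               ∎
    where open ≡-Reasoning

  -- for t ≡ 0 every term of the orbit sum is 1, and there are oddly many
  multiples-trivial : ∀ t → t % k ≡ 0 → multiples k t ≈ 𝟙
  multiples-trivial t t≡0 = by-parity λ P per → begin
    parity P (multiples k t)            ≡⟨ parity-multiples P k t ⟩
    parity (λ j → P (j * t)) (upTo k)   ≡⟨ parity-cong (λ j → trans (per (j * t)) (cong P (jt≡0 j))) (upTo k) ⟩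
    parity (λ _ → P 0) (upTo k)         ≡⟨ parity-period-const (P 0) ⟩
    P 0                                 ≡⟨ xor-identityʳ (P 0) ⟨
    parity P 𝟙                          ∎
    where
    open ≡-Reasoning
    jt≡0 : ∀ j → (j * t) % k ≡ 0
    0%k≡0 : 0 % k ≡ 0
    0%k≡0 = m*n%n≡0 0 k
    jt≡0 j = trans (*-congˡ-mod j (trans t≡0 (sym 0%k≡0))) (trans (cong (_% k) (*-zeroʳ j)) 0%k≡0)

  multiples-translate : ∀ t c s → s % k ≡ (c * t) % k → [ s ] ⊗ multiples k t ≈ multiples k t
  multiples-translate t c s s≡ct =
    ≈-trans (⊗-congˡ (multiples k t) (single-cong s≡ct)) (by-parity λ P per → begin
      parity P ([ c * t ] ⊗ multiples k t)
        ≡⟨ trans (parity-⊗ P [ c * t ] (multiples k t)) (xor-identityʳ _) ⟩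
      parity (λ b → P (c * t + b)) (multiples k t)
        ≡⟨ parity-multiples (λ b → P (c * t + b)) k t ⟩
      parity (λ j → P (c * t + j * t)) (upTo k)
        ≡⟨ parity-cong (λ j → cong P (sym (*-distribʳ-+ t c j))) (upTo k) ⟩
      parity (λ j → P ((c + j) * t)) (upTo k)
        ≡⟨ parity-translate (λ j → P (j * t)) k (periodic per) c ⟩
      parity (λ j → P (j * t)) (upTo k)
        ≡⟨ parity-multiples P k t ⟨
      parity P (multiples k t)
        ∎)
    where
    open ≡-Reasoning
    periodic : ∀ {P} → Periodic P → ∀ e → P ((e + k) * t) ≡ P (e * t)
    periodic {P} per e = begin
      P ((e + k) * t)           ≡⟨ per _ ⟩
      P (((e + k) * t) % k)     ≡⟨ cong (λ z → P (z % k)) (trans (*-distribʳ-+ t e k) (cong (e * t +_) (*-comm k t))) ⟩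
      P ((e * t + t * k) % k)   ≡⟨ cong P ([m+kn]%n≡m%n (e * t) t k) ⟩
      P ((e * t) % k)           ≡⟨ per (e * t) ⟨
      P (e * t)                 ∎

  multiples-absorb : ∀ t c s → s % k ≡ (c * t) % k → multiples k t ⊗ multiples k s ≈ multiples k t
  multiples-absorb t c s s≡ct = ≈-trans (⊗-comm (multiples k t) (multiples k s)) (by-parity λ P per → begin
    parity P (multiples k s ⊗ multiples k t)
      ≡⟨ parity-⊗ P (multiples k s) (multiples k t) ⟩
    parity (λ a → parity (λ b → P (a + b)) (multiples k t)) (multiples k s)
      ≡⟨ parity-multiples (λ a → parity (λ b → P (a + b)) (multiples k t)) k s ⟩
    parity (λ j → parity (λ b → P (j * s + b)) (multiples k t)) (upTo k)
      ≡⟨ parity-cong (λ j → trans (sym (xor-identityʳ _)) (trans (sym (parity-⊗ P [ j * s ] (multiples k t))) (test (translate j) P per))) (upTo k) ⟩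
    parity (λ _ → parity P (multiples k t)) (upTo k)
      ≡⟨ parity-period-const _ ⟩
    parity P (multiples k t)
      ∎)
    where
    open ≡-Reasoning
    translate : ∀ j → [ j * s ] ⊗ multiples k t ≈ multiples k t
    translate j = multiples-translate t (j * c) (j * s)
      (trans (*-congˡ-mod j s≡ct) (cong (_% k) (sym (*-assoc j c t))))

  half : ℕ
  half = k / 2

  k≡2half+1 : k ≡ suc (2 * half)
  k≡2half+1 = trans (m≡m%n+[m/n]*n k 2) (trans (cong (_+ half * 2) k-odd) (cong suc (*-comm half 2)))

  telescope : ∀ d → 𝟙 ++ (𝟙 ++ [ d ]) ⊗ oddMultiples half d ≈ multiples k d
  telescope d = by-parity λ P _ → begin
    P 0 xor parity P ((𝟙 ++ [ d ]) ⊗ W)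
      ≡⟨ cong (P 0 xor_) (parity-⊗ P (𝟙 ++ [ d ]) W) ⟩
    P 0 xor (parity P W xor (parity (λ b → P (d + b)) W xor false))
      ≡⟨ cong (λ z → P 0 xor (parity P W xor z)) (xor-identityʳ _) ⟩
    P 0 xor (parity P W xor parity (λ b → P (d + b)) W)
      ≡⟨ cong (P 0 xor_) (parity-oddMultiples P d half) ⟩
    P 0 xor parity (λ j → P (suc j * d)) (upTo (2 * half))
      ≡⟨ parity-upTo-suc (λ j → P (j * d)) (2 * half) ⟨
    parity (λ j → P (j * d)) (upTo (suc (2 * half)))
      ≡⟨ cong (λ n → parity (λ j → P (j * d)) (upTo n)) k≡2half+1 ⟨
    parity (λ j → P (j * d)) (upTo k)
      ≡⟨ parity-multiples P k d ⟨
    parity P (multiples k d)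
      ∎
    where
    open ≡-Reasoning
    W : List ℕ
    W = oddMultiples half d

inverse-mod-prime : ∀ p .{{_ : NonZero p}} → Prime p → ∀ u → u % p ≢ 0 → ∃ λ c → (c * u) % p ≡ 1
inverse-mod-prime p p-prime u u≢0 with coprime-Bézout u⊥p
  where
  u⊥p : Coprime u p
  u⊥p {d} (d∣u , d∣p) with prime⇒irreducible p-prime d∣p
  ... | inj₁ d≡1 = d≡1
  ... | inj₂ refl = ⊥-elim (u≢0 (n∣m⇒m%n≡0 u p d∣u))
... | Bézout.+- x y eq = x , (begin
  (x * u) % p     ≡⟨ cong (_% p) eq ⟨
  (1 + y * p) % p ≡⟨ [m+kn]%n≡m%n 1 y p ⟩
  1 % p           ≡⟨ m<n⇒m%n≡m 1<p ⟩
  1               ∎)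
  where
  open ≡-Reasoning
  1<p : 1 < p
  1<p = nonTrivial⇒n>1 p {{prime⇒nonTrivial p-prime}}
... | Bézout.-+ x y eq = q * x , (begin
  (q * x * u) % p                   ≡⟨ cong (_% p) (*-assoc q x u) ⟩
  (q * (x * u)) % p                 ≡⟨ [m+n]%n≡m%n (q * (x * u)) p ⟨
  (q * (x * u) + p) % p             ≡⟨ cong (λ z → (q * (x * u) + z) % p) p≡q+1 ⟩
  (q * (x * u) + (q + 1)) % p       ≡⟨ cong (_% p) (ring₁ q (x * u)) ⟩
  (q * (1 + x * u) + 1) % p         ≡⟨ cong (λ z → (q * z + 1) % p) eq ⟩
  (q * (y * p) + 1) % p             ≡⟨ cong (_% p) (ring₂ q y p) ⟩
  (1 + (q * y) * p) % p             ≡⟨ [m+kn]%n≡m%n 1 (q * y) p ⟩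
  1 % p                             ≡⟨ m<n⇒m%n≡m 1<p ⟩
  1                                 ∎)
  where
  open ≡-Reasoning
  1<p : 1 < p
  1<p = nonTrivial⇒n>1 p {{prime⇒nonTrivial p-prime}}
  q = p ∸ 1
  p≡q+1 : p ≡ q + 1
  p≡q+1 = sym (m∸n+n≡m (<⇒≤ 1<p))
  ring₁ : ∀ q a → q * a + (q + 1) ≡ q * (1 + a) + 1
  ring₁ = solve-∀
  ring₂ : ∀ q y p → q * (y * p) + 1 ≡ 1 + (q * y) * p
  ring₂ = solve-∀

orbit-contains-m : ∀ m p t .{{_ : NonZero m}} .{{_ : NonZero p}} .{{_ : NonZero (m * p)}} → Prime p →
  t % m ≡ 0 → t % (m * p) ≢ 0 → ∃ λ c → m % (m * p) ≡ (c * t) % (m * p)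
orbit-contains-m m p t p-prime m∣t mp∤t with inverse-mod-prime p p-prime (t / m) p∤u
  where
  p∤u : (t / m) % p ≢ 0
  p∤u p∣u = mp∤t (begin
    t % (m * p)                   ≡⟨ cong (_% (m * p)) (m/n*n≡m (m%n≡0⇒n∣m t m m∣t)) ⟨
    (t / m * m) % (m * p)         ≡⟨ cong (λ z → (z * m) % (m * p)) (m/n*n≡m (m%n≡0⇒n∣m (t / m) p p∣u)) ⟨
    (t / m / p * p * m) % (m * p) ≡⟨ cong (_% (m * p)) (ring (t / m / p) p m) ⟩
    (t / m / p * (m * p)) % (m * p) ≡⟨ m*n%n≡0 (t / m / p) (m * p) ⟩
    0                             ∎)
    where
    open ≡-Reasoning
    ring : ∀ a p m → a * p * m ≡ a * (m * p)
    ring = solve-∀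
... | c , cu≡1 = c , sym (begin
  (c * t) % (m * p)                              ≡⟨ cong (λ z → (c * z) % (m * p)) (m/n*n≡m (m%n≡0⇒n∣m t m m∣t)) ⟨
  (c * (u * m)) % (m * p)                        ≡⟨ cong (_% (m * p)) (*-assoc c u m) ⟨
  (c * u * m) % (m * p)                          ≡⟨ cong (λ z → (z * m) % (m * p)) (m≡m%n+[m/n]*n (c * u) p) ⟩
  (((c * u) % p + (c * u) / p * p) * m) % (m * p) ≡⟨ cong (λ z → ((z + (c * u) / p * p) * m) % (m * p)) cu≡1 ⟩
  ((1 + (c * u) / p * p) * m) % (m * p)          ≡⟨ cong (_% (m * p)) (ring ((c * u) / p) p m) ⟩
  (m + (c * u) / p * (m * p)) % (m * p)          ≡⟨ [m+kn]%n≡m%n m ((c * u) / p) (m * p) ⟩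
  m % (m * p)                                    ∎)
  where
  open ≡-Reasoning
  u : ℕ
  u = t / m
  ring : ∀ q p m → (1 + q * p) * m ≡ m + q * (m * p)
  ring = solve-∀

prime-divisor-split : ∀ m p .{{_ : NonZero m}} .{{_ : NonZero p}} → Prime p → m % p ≡ 0 →
  (m / p) % m ≢ 0 × p * (m / p) ≡ m
prime-divisor-split m p p-prime p∣m = m/p≢0 , m*[n/m]≡n (m%n≡0⇒n∣m m p p∣m)
  where
  m/p≢0 : (m / p) % m ≢ 0
  m/p≢0 e = <⇒≱ (m/n≡0⇒m<n (trans (sym (m<n⇒m%n≡m (m/n<m m p (nonTrivial⇒n>1 p {{prime⇒nonTrivial p-prime}})))) e))
                (∣⇒≤ (m%n≡0⇒n∣m m p p∣m))

odd-factor : ∀ a b → (a * b) % 2 ≡ 1 → a % 2 ≡ 1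
odd-factor a b ab-odd with a % 2 in eq | m%n<n a 2
... | 1 | _ = refl
... | 0 | _ = ⊥-elim (0≢1+n (trans (sym (trans (%-distribˡ-* a b 2) (cong (λ v → (v * (b % 2)) % 2) eq))) ab-odd))
... | suc (suc _) | s≤s (s≤s ())

-- A primitive element of F₂[ℤ/k]: a nonzero element annihilating the orbit sum of every
-- nonzero residue.  (Such elements live in the component of the group algebra on which
-- a generator acts as a primitive k-th root of unity.)
record Primitive (k : ℕ) .{{_ : NonZero k}} : Set where
  open GroupAlgebra k using (_≈_)
  field
    element     : List ℕ
    nonzero     : ¬ element ≈ []
    annihilates : ∀ t → t % k ≢ 0 → element ⊗ multiples k t ≈ []

-- From a primitive element modulo m one obtains one modulo m·p, for a prime p with m·p odd.
-- It is built from the image of the old one under the embedding ι : g ↦ gᵖ.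
module PrimeStep (m p : ℕ) .{{_ : NonZero m}} .{{_ : NonZero p}} (p-prime : Prime p)
                 (k-odd : (m * p) % 2 ≡ 1) where

  k : ℕ
  k = m * p

  instance
    k≢0 : NonZero k
    k≢0 = m*n≢0 m p

  module Gm = GroupAlgebra m
  open GroupAlgebra k
  open OddModulus k k-odd

  p-odd : p % 2 ≡ 1
  p-odd = odd-factor p m (trans (cong (_% 2) (*-comm p m)) k-odd)

  ι : List ℕ → List ℕ
  ι = map (p *_)

  p*-mod : ∀ e → (p * e) % k ≡ p * (e % m)
  p*-mod e = trans (cong (_% k) (*-comm p e)) (trans (sym (m%n*o≡m*o%[n*o] e m p)) (*-comm (e % m) p))

  ι-periodic : ∀ P → Periodic P → Gm.Periodic (P ∘ (p *_))
  ι-periodic P per e = begin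
    P (p * e)                ≡⟨ per (p * e) ⟩
    P ((p * e) % k)          ≡⟨ cong P (p*-mod e) ⟩
    P (p * (e % m))          ≡⟨ cong (λ z → P (p * z)) (m%n%n≡m%n e m) ⟨
    P (p * (e % m % m))      ≡⟨ cong P (p*-mod (e % m)) ⟨
    P ((p * (e % m)) % k)    ≡⟨ per (p * (e % m)) ⟨
    P (p * (e % m))          ∎
    where open ≡-Reasoning

  ι-cong : ∀ {x y} → x Gm.≈ y → ι x ≈ ι y
  ι-cong {x} {y} x≈y = by-parity λ P per →
    trans (parity-map P (p *_) x)
      (trans (Gm.test x≈y (P ∘ (p *_)) (ι-periodic P per)) (sym (parity-map P (p *_) y)))

  ι-⊗ : ∀ x y → ι (x ⊗ y) ≈ ι x ⊗ ι y
  ι-⊗ x y = by-parity λ P _ → begin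
    parity P (ι (x ⊗ y))
      ≡⟨ parity-map P (p *_) (x ⊗ y) ⟩
    parity (λ e → P (p * e)) (x ⊗ y)
      ≡⟨ parity-⊗ (λ e → P (p * e)) x y ⟩
    parity (λ a → parity (λ b → P (p * (a + b))) y) x
      ≡⟨ parity-cong (λ a → parity-cong (λ b → cong P (*-distribˡ-+ p a b)) y) x ⟩
    parity (λ a → parity (λ b → P (p * a + p * b)) y) x
      ≡⟨ parity-cong (λ a → parity-map (λ b → P (p * a + b)) (p *_) y) x ⟨
    parity (λ a → parity (λ b → P (p * a + b)) (ι y)) x
      ≡⟨ parity-map (λ a → parity (λ b → P (a + b)) (ι y)) (p *_) x ⟨
    parity (λ a → parity (λ b → P (a + b)) (ι y)) (ι x)
      ≡⟨ parity-⊗ P (ι x) (ι y) ⟨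
    parity P (ι x ⊗ ι y)
      ∎
    where open ≡-Reasoning

  -- the orbit of gᵖᵗ in ℤ/mp is the image of the orbit of gᵗ in ℤ/m, traversed p (odd) times
  ι-multiples : ∀ t → multiples k (p * t) ≈ ι (multiples m t)
  ι-multiples t = by-parity same-parity
    where
    open ≡-Reasoning
    ring₁ : ∀ j p t → j * (p * t) ≡ p * (j * t)
    ring₁ = solve-∀
    ring₂ : ∀ m j p t → (m + j) * (p * t) ≡ j * (p * t) + t * (m * p)
    ring₂ = solve-∀
    periodic : ∀ P → Periodic P → ∀ j → P ((m + j) * (p * t)) ≡ P (j * (p * t))
    periodic P per j = begin
      P ((m + j) * (p * t))                   ≡⟨ per _ ⟩
      P (((m + j) * (p * t)) % k)             ≡⟨ cong (λ z → P (z % k)) (ring₂ m j p t) ⟩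
      P ((j * (p * t) + t * k) % k)           ≡⟨ cong P ([m+kn]%n≡m%n (j * (p * t)) t k) ⟩
      P ((j * (p * t)) % k)                   ≡⟨ per _ ⟨
      P (j * (p * t))                         ∎
    same-parity : ∀ P → Periodic P → parity P (multiples k (p * t)) ≡ parity P (ι (multiples m t))
    same-parity P per = let Q = λ j → P (j * (p * t)) in begin
      parity P (multiples k (p * t))
        ≡⟨ parity-multiples P k (p * t) ⟩
      parity Q (upTo (m * p))
        ≡⟨ cong (parity Q ∘ upTo) (*-comm m p) ⟩
      parity Q (upTo (p * m))
        ≡⟨ parity-repeat Q m (periodic P per) p ⟩
      parity Q (upTo m) ∧ isOdd p
        ≡⟨ cong (parity Q (upTo m) ∧_) (isOdd-complete p p-odd) ⟩
      parity Q (upTo m) ∧ true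
        ≡⟨ ∧-identityʳ _ ⟩
      parity Q (upTo m)
        ≡⟨ parity-cong (λ j → cong P (ring₁ j p t)) (upTo m) ⟩
      parity (λ j → P (p * (j * t))) (upTo m)
        ≡⟨ parity-multiples (λ e → P (p * e)) m t ⟨
      parity (λ e → P (p * e)) (multiples m t)
        ≡⟨ parity-map P (p *_) (multiples m t) ⟨
      parity P (ι (multiples m t))
        ∎

  -- Testing ι x against `descend P` recovers the test of x against P; this lets zero-ness be
  -- pulled back along ι.
  descend : (ℕ → Bool) → ℕ → Bool
  descend P x = (x % p ≡ᵇ 0) ∧ P (x / p)

  descend-periodic : ∀ P → Gm.Periodic P → Periodic (descend P)
  descend-periodic P per x = cong₂ (λ a b → (a ≡ᵇ 0) ∧ b)
    (sym (m∣n⇒o%n%m≡o%m p k x (divides m refl)))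
    (trans (per (x / p)) (cong P (sym (m%[n*o]/o≡m/o%n x m p))))

  parity-descend : ∀ P x → parity (descend P) (ι x) ≡ parity P x
  parity-descend P x = trans (parity-map (descend P) (p *_) x) (parity-cong descend-ι x)
    where
    descend-ι : ∀ e → descend P (p * e) ≡ P e
    descend-ι e = cong₂ (λ a b → (a ≡ᵇ 0) ∧ P b)
      (trans (cong (_% p) (*-comm p e)) (m*n%n≡0 e p)) (trans (cong (_/ p) (*-comm p e)) (m*n/n≡m e p))

  ι-reflects-zero : ∀ {x} → ι x ≈ [] → x Gm.≈ []
  ι-reflects-zero {x} ιx≈0 = Gm.by-parity λ P per →
    trans (sym (parity-descend P x)) (test ιx≈0 (descend P) (descend-periodic P per))

  -- when p ∤ m, the translate gᵐ·ι x is invisible to the descended tests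
  ι-reflects-zero′ : m % p ≢ 0 → ∀ {x} → (𝟙 ++ [ m ]) ⊗ ι x ≈ [] → x Gm.≈ []
  ι-reflects-zero′ p∤m {x} e≈0 = Gm.by-parity λ P per → begin
    parity P x
      ≡⟨ parity-descend P x ⟨
    parity (descend P) (ι x)
      ≡⟨ xor-identityʳ _ ⟨
    parity (descend P) (ι x) xor false
      ≡⟨ cong (parity (descend P) (ι x) xor_) (shifted-invisible P) ⟨
    parity (descend P) (ι x) xor (parity (λ b → descend P (m + b)) (ι x) xor false)
      ≡⟨ parity-⊗ (descend P) (𝟙 ++ [ m ]) (ι x) ⟨
    parity (descend P) ((𝟙 ++ [ m ]) ⊗ ι x)
      ≡⟨ test e≈0 (descend P) (descend-periodic P per) ⟩
    false
      ∎
    where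
    open ≡-Reasoning
    not-divisible : ∀ e → ((m + p * e) % p ≡ᵇ 0) ≡ false
    not-divisible e with (m + p * e) % p in eq
    ... | zero  = ⊥-elim (p∤m (trans (sym (trans (cong (λ z → (m + z) % p) (*-comm p e)) ([m+kn]%n≡m%n m e p))) eq))
    ... | suc _ = refl
    shifted-invisible : ∀ P → parity (λ b → descend P (m + b)) (ι x) xor false ≡ false
    shifted-invisible P = begin
      parity (λ b → descend P (m + b)) (ι x) xor false  ≡⟨ xor-identityʳ _ ⟩
      parity (λ b → descend P (m + b)) (ι x)            ≡⟨ parity-map (λ b → descend P (m + b)) (p *_) x ⟩
      parity (λ e → descend P (m + p * e)) x            ≡⟨ parity-cong (λ e → cong (_∧ P ((m + p * e) / p)) (not-divisible e)) x ⟩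
      parity (λ _ → false) x                            ≡⟨ parity-false x ⟩
      false                                             ∎

  -- Given a primitive U modulo m, the candidate is V = ι U when p ∣ m and (1 + gᵐ)·V otherwise.
  module _ (U-primitive : Primitive m) where
    open Primitive U-primitive renaming (element to U; nonzero to U≉0; annihilates to U-annihilates)
    open ≈-Reasoning setoid

    V : List ℕ
    V = ι U

    V-annihilates-ι : ∀ s → s % m ≢ 0 → V ⊗ multiples k (p * s) ≈ []
    V-annihilates-ι s s≢0 = begin
      V ⊗ multiples k (p * s)  ≈⟨ ⊗-congʳ V (ι-multiples s) ⟩
      ι U ⊗ ι (multiples m s)  ≈⟨ ι-⊗ U (multiples m s) ⟨
      ι (U ⊗ multiples m s)    ≈⟨ ι-cong (U-annihilates s s≢0) ⟩
      []                       ∎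

    V-annihilates : ∀ t → t % m ≢ 0 → V ⊗ multiples k t ≈ []
    V-annihilates t t≢0 = annihilate-via V (multiples k t) (multiples k (p * t))
      (multiples-absorb t p (p * t) refl) (V-annihilates-ι t t≢0)

    V-primitive : m % p ≡ 0 → ∀ t → t % k ≢ 0 → V ⊗ multiples k t ≈ []
    V-primitive p∣m t t≢0 with t % m ≟ 0
    ... | no m∤t = V-annihilates t m∤t
    ... | yes m∣t =
      let (c , m∈⟨t⟩)          = orbit-contains-m m p t p-prime m∣t t≢0
          (m/p≢0 , p[m/p]≡m)  = prime-divisor-split m p p-prime p∣m
      in annihilate-via V (multiples k t) (multiples k m) (multiples-absorb t c m m∈⟨t⟩)
           (subst (λ z → V ⊗ multiples k z ≈ []) p[m/p]≡m (V-annihilates-ι (m / p) m/p≢0))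

    -- when p ∤ m, the factor 1 + gᵐ kills the remaining orbit sums
    W : List ℕ
    W = (𝟙 ++ [ m ]) ⊗ V

    W-primitive : ∀ t → t % k ≢ 0 → W ⊗ multiples k t ≈ []
    W-primitive t t≢0 with t % m ≟ 0
    ... | no m∤t = begin
      W ⊗ multiples k t                   ≈⟨ ⊗-assoc (𝟙 ++ [ m ]) V (multiples k t) ⟩
      (𝟙 ++ [ m ]) ⊗ (V ⊗ multiples k t)  ≈⟨ ⊗-congʳ (𝟙 ++ [ m ]) (V-annihilates t m∤t) ⟩
      (𝟙 ++ [ m ]) ⊗ []                   ≈⟨ ⊗-zeroʳ (𝟙 ++ [ m ]) ⟩
      []                                  ∎
    ... | yes m∣t = let (c , m∈⟨t⟩) = orbit-contains-m m p t p-prime m∣t t≢0 in begin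
      W ⊗ multiples k t                        ≈⟨ ⊗-congˡ (multiples k t) (⊗-comm (𝟙 ++ [ m ]) V) ⟩
      V ⊗ (𝟙 ++ [ m ]) ⊗ multiples k t         ≈⟨ ⊗-assoc V (𝟙 ++ [ m ]) (multiples k t) ⟩
      V ⊗ ((𝟙 ++ [ m ]) ⊗ multiples k t)       ≈⟨ ⊗-congʳ V (⊗-distribʳ 𝟙 [ m ] (multiples k t)) ⟩
      V ⊗ (𝟙 ⊗ multiples k t ++ [ m ] ⊗ multiples k t)
        ≈⟨ ⊗-congʳ V (++-cong (⊗-identityˡ (multiples k t)) (multiples-translate t c m m∈⟨t⟩)) ⟩
      V ⊗ (multiples k t ++ multiples k t)     ≈⟨ ⊗-congʳ V (++-self (multiples k t)) ⟩
      V ⊗ []                                   ≈⟨ ⊗-zeroʳ V ⟩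
      []                                       ∎

    primitive-step : Primitive k
    primitive-step with m % p ≟ 0
    ... | yes p∣m = record { element = V ; nonzero = U≉0 ∘ ι-reflects-zero ; annihilates = V-primitive p∣m }
    ... | no  p∤m = record { element = W ; nonzero = U≉0 ∘ ι-reflects-zero′ p∤m ; annihilates = W-primitive }

primitive-cong : ∀ {a b} .{{_ : NonZero a}} .{{_ : NonZero b}} → a ≡ b → Primitive a → Primitive b
primitive-cong refl u = u

primitive-1 : Primitive 1
primitive-1 = record
  { element     = 𝟙
  ; nonzero     = λ 𝟙≈0 → contradiction (test 𝟙≈0 (λ _ → true) (λ _ → refl)) λ ()
  ; annihilates = λ t t≢0 → ⊥-elim (t≢0 (n%1≡0 t))
  }
  where open GroupAlgebra 1

primitive-product : ∀ {ps} .{{_ : NonZero (product ps)}} → All Prime ps → product ps % 2 ≡ 1 →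
  Primitive (product ps)
primitive-product {[]}     []                      _     = primitive-1
primitive-product {p ∷ qs} (p-prime ∷ qs-prime) pq-odd =
  primitive-cong (*-comm q p) (PrimeStep.primitive-step q p p-prime qp-odd (primitive-product qs-prime q-odd))
  where
  q : ℕ
  q = product qs
  instance
    p≢0 : NonZero p
    p≢0 = prime⇒nonZero p-prime
    q≢0 : NonZero q
    q≢0 = productOfPrimes≢0 qs-prime
    qp≢0 : NonZero (q * p)
    qp≢0 = m*n≢0 q p
  qp-odd : (q * p) % 2 ≡ 1
  qp-odd = trans (cong (_% 2) (*-comm q p)) pq-odd
  q-odd : q % 2 ≡ 1
  q-odd = odd-factor q p qp-odd

primitive-exists : ∀ k .{{_ : NonZero k}} → k % 2 ≡ 1 → Primitive k
primitive-exists k k-odd =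
  primitive-cong (sym isFactorisation) (primitive-product factorsPrime (subst (λ n → n % 2 ≡ 1) isFactorisation k-odd))
  where
  open PrimeFactorisation (factorise k)
  instance
    ∏≢0 : NonZero (product factors)
    ∏≢0 = productOfPrimes≢0 factorsPrime

-- On a primitive element U of F₂[ℤ/k], k odd, 1 + gᵈ acts invertibly for every d ≢ 0:
-- by telescoping, oddMultiples half d is an inverse.
module PrimitiveUnit (k : ℕ) .{{_ : NonZero k}} (k-odd : k % 2 ≡ 1) (U-primitive : Primitive k) where
  open GroupAlgebra k
  open Modular k
  open OddModulus k k-odd
  open Primitive U-primitive renaming (element to U; annihilates to U-annihilates)
  open ≈-Reasoning setoid

  unit-on-primitive : ∀ d → d % k ≢ 0 → U ⊗ ((𝟙 ++ [ d ]) ⊗ oddMultiples half d) ≈ U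
  unit-on-primitive d d≢0 = begin
    U ⊗ X                         ≈⟨ ⊗-congʳ U X≈1+multiples ⟩
    U ⊗ (𝟙 ++ multiples k d)      ≈⟨ ⊗-distribˡ U 𝟙 (multiples k d) ⟩
    U ⊗ 𝟙 ++ U ⊗ multiples k d    ≈⟨ ++-cong (⊗-identityʳ U) (U-annihilates d d≢0) ⟩
    U ++ []                       ≈⟨ ≡⇒≈ (++-identityʳ U) ⟩
    U                             ∎
    where
    X : List ℕ
    X = (𝟙 ++ [ d ]) ⊗ oddMultiples half d
    X≈1+multiples : X ≈ 𝟙 ++ multiples k d
    X≈1+multiples = begin
      X                ≈⟨ ++-cong (++-self 𝟙) ≈-refl ⟨
      (𝟙 ++ 𝟙) ++ X    ≈⟨ ≡⇒≈ (++-assoc 𝟙 𝟙 X) ⟩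
      𝟙 ++ (𝟙 ++ X)    ≈⟨ ++-cong ≈-refl (telescope d) ⟩
      𝟙 ++ multiples k d ∎

  pair-unit : ∀ a b → a % k ≢ b % k → U ⊗ (([ a ] ++ [ b ]) ⊗ ([ k ∸ b % k ] ⊗ oddMultiples half (a ⊖ b))) ≈ U
  pair-unit a b a≢b = begin
    U ⊗ (([ a ] ++ [ b ]) ⊗ ([ k ∸ b % k ] ⊗ W))   ≈⟨ ⊗-congʳ U (⊗-assoc ([ a ] ++ [ b ]) [ k ∸ b % k ] W) ⟨
    U ⊗ (([ a ⊖ b ] ++ [ b ⊖ b ]) ⊗ W)             ≈⟨ ⊗-congʳ U (⊗-congˡ W (++-cong {[ a ⊖ b ]} ≈-refl (single-cong {b ⊖ b} {0} b⊖b≡0))) ⟩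
    U ⊗ (([ a ⊖ b ] ++ 𝟙) ⊗ W)                     ≈⟨ ⊗-congʳ U (⊗-congˡ W (++-comm [ a ⊖ b ] 𝟙)) ⟩
    U ⊗ ((𝟙 ++ [ a ⊖ b ]) ⊗ W)                     ≈⟨ unit-on-primitive (a ⊖ b) (a≢b ∘ ⊖≡0⇒≡ a b) ⟩
    U                                              ∎
    where
    W : List ℕ
    W = oddMultiples half (a ⊖ b)
    b⊖b≡0 : (b ⊖ b) % k ≡ 0 % k
    b⊖b≡0 = trans (⊖-self b) (sym (m*n%n≡0 0 k))

sum-allFin : ∀ n (f : Fin n → ℕ) → ListAction.sum (map f (allFin n)) ≡ ∑[ i < n ] f i
sum-allFin n f = trans (cong ListAction.sum (map-tabulate id f)) (sum-tabulate n f)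
  where
  sum-tabulate : ∀ n (f : Fin n → ℕ) → ListAction.sum (tabulate f) ≡ ∑[ i < n ] f i
  sum-tabulate zero    f = refl
  sum-tabulate (suc n) f = cong (f fzero +_) (sum-tabulate n (f ∘ fsuc))

indicator : ∀ {n} → Fin n → Fin n → ℕ
indicator a b = if does (a ≟F b) then 1 else 0

∑-indicator : ∀ n (a : Fin n → ℕ) t → ∑[ v < n ] (a v * indicator t v) ≡ a t
∑-indicator (suc n) a fzero = trans (cong₂ _+_ (*-identityʳ (a fzero))
  (trans (sum-cong-≗ (λ v → *-zeroʳ (a (fsuc v)))) (sum-replicate-zero n))) (+-identityʳ (a fzero))
∑-indicator (suc n) a (fsuc t) = trans (cong (_+ ∑[ v < n ] (a (fsuc v) * indicator t v)) (*-zeroʳ (a fzero)))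
  (∑-indicator n (a ∘ fsuc) t)

∑-cong-mod : ∀ k .{{_ : NonZero k}} N {f g : Fin N → ℕ} → (∀ i → f i % k ≡ g i % k) →
  (∑[ i < N ] f i) % k ≡ (∑[ i < N ] g i) % k
∑-cong-mod k zero    f≡g = refl
∑-cong-mod k (suc N) f≡g = Modular.+-cong-mod k (f≡g fzero) (∑-cong-mod k N (f≡g ∘ fsuc))

module _ {n} (L : Graph n) where

  -- outdeg is defined through a local decision function; naming its summand lets us compare
  -- it, case by case, with the indicator of `tail = x`
  private
    outdegSummands : ∀ o x → Σ (Fin (m L) → ℕ) λ f → outdeg L o x ≡ ListAction.sum (map f (allFin (m L)))
    outdegSummands o x = _ , refl

    summand-indicator : ∀ o x e → proj₁ (outdegSummands o x) e ≡ indicator (tail L o e) x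
    summand-indicator o x e with tail L o e ≟F x
    ... | yes _ = refl
    ... | no  _ = refl

  outdeg-indicator : ∀ o x → outdeg L o x ≡ ∑[ e < m L ] indicator (tail L o e) x
  outdeg-indicator o x = begin
    outdeg L o x                                          ≡⟨ proj₂ (outdegSummands o x) ⟩
    ListAction.sum (map (proj₁ (outdegSummands o x)) (allFin (m L)))
                                                          ≡⟨ sum-allFin (m L) _ ⟩
    ∑[ e < m L ] proj₁ (outdegSummands o x) e             ≡⟨ sum-cong-≗ (summand-indicator o x) ⟩
    ∑[ e < m L ] indicator (tail L o e) x                 ∎
    where open ≡-Reasoning

  weighted-outdeg : ∀ (a : Fin n → ℕ) o →
    ∑[ v < n ] (a v * outdeg L o v) ≡ ∑[ e < m L ] a (tail L o e)
  weighted-outdeg a o = begin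
    ∑[ v < n ] (a v * outdeg L o v)                             ≡⟨ sum-cong-≗ (λ v → cong (a v *_) (outdeg-indicator o v)) ⟩
    ∑[ v < n ] (a v * ∑[ e < m L ] indicator (tail L o e) v)   ≡⟨ sum-cong-≗ (λ v → *-distribˡ-sum (a v) (λ e → indicator (tail L o e) v)) ⟩
    ∑[ v < n ] ∑[ e < m L ] (a v * indicator (tail L o e) v)   ≡⟨ ∑-comm (λ v e → a v * indicator (tail L o e) v) ⟩
    ∑[ e < m L ] ∑[ v < n ] (a v * indicator (tail L o e) v)   ≡⟨ sum-cong-≗ (λ e → ∑-indicator n a (tail L o e)) ⟩
    ∑[ e < m L ] a (tail L o e)                               ∎
    where open ≡-Reasoning

module Expansions (k : ℕ) .{{_ : NonZero k}} where
  open GroupAlgebra k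

  pair-⊗ : (xs : List A) (S : A → ℕ) (a b : ℕ) →
    map (λ x → a + S x) xs ++ map (λ x → b + S x) xs ≈ ([ a ] ++ [ b ]) ⊗ map S xs
  pair-⊗ xs S a b = ≡⇒≈ (cong₂ _++_ (map-∘ xs) (trans (map-∘ xs) (sym (++-identityʳ _))))

  choice-expansion : ∀ M (g : Fin M → Bool → ℕ) →
    map (λ o → ∑[ e < M ] g e (lookup o e)) (allVecs M) ≈ ∏ M (λ e → [ g e true ] ++ [ g e false ])
  choice-expansion zero    g = ≈-refl
  choice-expansion (suc M) g = begin
    map F (map (true ∷ᵥ_) Os ++ map (false ∷ᵥ_) Os)
      ≈⟨ ≡⇒≈ (trans (map-++ F (map (true ∷ᵥ_) Os) _) (cong₂ _++_ (sym (map-∘ Os)) (sym (map-∘ Os)))) ⟩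
    map (λ o → g fzero true + S o) Os ++ map (λ o → g fzero false + S o) Os
      ≈⟨ pair-⊗ Os S (g fzero true) (g fzero false) ⟩
    ([ g fzero true ] ++ [ g fzero false ]) ⊗ map S Os
      ≈⟨ ⊗-congʳ ([ g fzero true ] ++ [ g fzero false ]) (choice-expansion M (g ∘ fsuc)) ⟩
    ([ g fzero true ] ++ [ g fzero false ]) ⊗ ∏ M (λ e → [ g (fsuc e) true ] ++ [ g (fsuc e) false ])
      ∎
    where
    open ≈-Reasoning setoid
    Os : List (Vec Bool M)
    Os = allVecs M
    F : Vec Bool (suc M) → ℕ
    F o = ∑[ e < suc M ] g e (lookup o e)
    S : Vec Bool M → ℕ
    S o = ∑[ e < M ] g (fsuc e) (lookup o e)

  colorings : ∀ n → List (Fin n → Fin k)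
  colorings zero    = [ []ᶠ ]
  colorings (suc n) = concatMap (λ j → map (j ∷ᶠ_) (colorings n)) (allFin k)

  coloring-expansion : ∀ n (t : Fin n → ℕ) →
    map (λ c → ∑[ v < n ] (toℕ (c v) * t v)) (colorings n) ≈ ∏ n (λ v → multiples k (t v))
  coloring-expansion zero    t = ≈-refl
  coloring-expansion (suc n) t = by-parity same-parity
    where
    open ≡-Reasoning
    Cs : List (Fin n → Fin k)
    Cs = colorings n
    S : (Fin n → Fin k) → ℕ
    S c = ∑[ v < n ] (toℕ (c v) * t (fsuc v))
    Rest : List ℕ
    Rest = ∏ n (λ v → multiples k (t (fsuc v)))
    same-parity : ∀ P → Periodic P →
      parity P (map (λ c → ∑[ v < suc n ] (toℕ (c v) * t v)) (colorings (suc n)))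
        ≡ parity P (multiples k (t fzero) ⊗ Rest)
    same-parity P per = begin
      parity P (map _ (colorings (suc n)))
        ≡⟨ parity-map P _ (colorings (suc n)) ⟩
      parity _ (concatMap (λ j → map (j ∷ᶠ_) Cs) (allFin k))
        ≡⟨ parity-concatMap _ (λ j → map (j ∷ᶠ_) Cs) (allFin k) ⟩
      parity (λ j → parity _ (map (j ∷ᶠ_) Cs)) (allFin k)
        ≡⟨ parity-cong (λ j → parity-map _ (j ∷ᶠ_) Cs) (allFin k) ⟩
      parity (λ j → parity (λ c → P (toℕ j * t fzero + S c)) Cs) (allFin k)
        ≡⟨ parity-cong (λ j → sym (parity-map (λ b → P (toℕ j * t fzero + b)) S Cs)) (allFin k) ⟩
      parity (λ j → parity (λ b → P (toℕ j * t fzero + b)) (map S Cs)) (allFin k)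
        ≡⟨ parity-cong (λ j → test (coloring-expansion n (t ∘ fsuc)) _ (periodic-shift per _)) (allFin k) ⟩
      parity (λ j → parity (λ b → P (toℕ j * t fzero + b)) Rest) (allFin k)
        ≡⟨ parity-map (λ a → parity (λ b → P (a * t fzero + b)) Rest) toℕ (allFin k) ⟨
      parity (λ a → parity (λ b → P (a * t fzero + b)) Rest) (map toℕ (allFin k))
        ≡⟨ cong (parity (λ a → parity (λ b → P (a * t fzero + b)) Rest)) (allFin-upTo k) ⟩
      parity (λ a → parity (λ b → P (a * t fzero + b)) Rest) (upTo k)
        ≡⟨ parity-multiples (λ a → parity (λ b → P (a + b)) Rest) k (t fzero) ⟨
      parity (λ a → parity (λ b → P (a + b)) Rest) (multiples k (t fzero))
        ≡⟨ parity-⊗ P (multiples k (t fzero)) Rest ⟨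
      parity P (multiples k (t fzero) ⊗ Rest)
        ∎

parity-filter : {P : A → Set} (P? : U.Decidable P) (f : A → Bool) (xs : List A) →
  parity f (filter P? xs) ≡ parity (λ x → does (P? x) ∧ f x) xs
parity-filter P? f []       = refl
parity-filter P? f (x ∷ xs) with does (P? x)
... | true  = cong (f x xor_) (parity-filter P? f xs)
... | false = parity-filter P? f xs

-- Proof by strong induction on the length of xs: the class of the first
-- element contributes nothing, and removing it leaves a list of the same kind.
module EvenClasses {_∼_ : Rel A 0ℓ} (∼-equivalence : IsEquivalence _∼_) (_∼?_ : Decidable _∼_) where
  open IsEquivalence ∼-equivalence renaming (refl to ∼-refl; sym to ∼-sym; trans to ∼-trans)

  EvenClass : List A → A → Set
  EvenClass xs x = parity (does ∘ (x ∼?_)) xs ≡ false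

  parity-even-classes : (f : A → Bool) → (∀ x y → x ∼ y → f x ≡ f y) →
    ∀ xs → (∀ x → x ∈ xs → EvenClass xs x) → parity f xs ≡ false
  parity-even-classes f f-resp zs = go (length zs) zs ≤-refl
    where
    go : ∀ n xs → length xs ≤ n → (∀ x → x ∈ xs → EvenClass xs x) → parity f xs ≡ false
    go _       []         _         _    = refl
    go (suc n) (o ∷ rest) (s≤s len) even = begin
      parity f xs
        ≡⟨ parity-cong (λ x → split (does (o ∼? x)) (f x)) xs ⟩
      parity (λ x → (does (o ∼? x) ∧ f x) xor (not (does (o ∼? x)) ∧ f x)) xs
        ≡⟨ parity-xor (λ x → does (o ∼? x) ∧ f x) (λ x → not (does (o ∼? x)) ∧ f x) xs ⟩
      parity (λ x → does (o ∼? x) ∧ f x) xs xor parity (λ x → not (does (o ∼? x)) ∧ f x) xs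
        ≡⟨ cong₂ _xor_ class-of-o (sym (parity-filter outside f xs)) ⟩
      false xor parity f ys
        ≡⟨ go n ys ys-length ys-even ⟩
      false
        ∎
      where
      open ≡-Reasoning
      xs : List A
      xs = o ∷ rest
      outside : U.Decidable (λ x → ¬ o ∼ x)
      outside x = ¬? (o ∼? x)
      ys : List A
      ys = filter outside xs

      split : ∀ b c → c ≡ (b ∧ c) xor (not b ∧ c)
      split true  c = sym (xor-identityʳ c)
      split false c = refl

      -- on the class of o, f is constantly f o, and that class is even
      class-of-o : parity (λ x → does (o ∼? x) ∧ f x) xs ≡ false
      class-of-o = begin
        parity (λ x → does (o ∼? x) ∧ f x) xs    ≡⟨ parity-cong on-class xs ⟩
        parity (λ x → f o ∧ does (o ∼? x)) xs    ≡⟨ parity-∧ (f o) (does ∘ (o ∼?_)) xs ⟩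
        f o ∧ parity (does ∘ (o ∼?_)) xs         ≡⟨ cong (f o ∧_) (even o (here refl)) ⟩
        f o ∧ false                              ≡⟨ ∧-zeroʳ (f o) ⟩
        false                                    ∎
        where
        on-class : ∀ x → does (o ∼? x) ∧ f x ≡ f o ∧ does (o ∼? x)
        on-class x with o ∼? x
        ... | yes o∼x = trans (sym (f-resp o x o∼x)) (sym (∧-identityʳ (f o)))
        ... | no  _   = sym (∧-zeroʳ (f o))

      ys-length : length ys ≤ n
      ys-length with o ∼? o
      ... | yes _   = ≤-trans (length-filter outside rest) len
      ... | no o≁o = contradiction ∼-refl o≁o

      -- a class other than that of o meets ys exactly where it meets xs
      ys-even : ∀ y → y ∈ ys → EvenClass ys y
      ys-even y y∈ys with ∈-filter⁻ outside {xs = xs} y∈ys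
      ... | y∈xs , o≁y = begin
        parity (does ∘ (y ∼?_)) ys                          ≡⟨ parity-filter outside (does ∘ (y ∼?_)) xs ⟩
        parity (λ x → does (outside x) ∧ does (y ∼? x)) xs  ≡⟨ parity-cong same-class xs ⟩
        parity (does ∘ (y ∼?_)) xs                          ≡⟨ even y y∈xs ⟩
        false                                               ∎
        where
        same-class : ∀ x → does (outside x) ∧ does (y ∼? x) ≡ does (y ∼? x)
        same-class x with y ∼? x | o ∼? x
        ... | no  _   | _       = ∧-zeroʳ _
        ... | yes _   | no _    = refl
        ... | yes y∼x | yes o∼x = contradiction (∼-trans o∼x (∼-sym y∼x)) o≁y

congruent-equivalence : ∀ {n} (L : Graph n) (k : ℕ) .{{_ : NonZero k}} → IsEquivalence (Congruent L k)
congruent-equivalence L k = record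
  { refl  = λ _ → refl
  ; sym   = λ o∼o′ x → sym (o∼o′ x)
  ; trans = λ o∼o′ o′∼o″ x → trans (o∼o′ x) (o′∼o″ x)
  }

module ColoringTheorem (k : ℕ) .{{_ : NonZero k}} (k-odd : k % 2 ≡ 1) {n : ℕ} (L : Graph n) where
  open GroupAlgebra k
  open Modular k
  open OddModulus k k-odd
  open Expansions k
  open Primitive (primitive-exists k k-odd) renaming (element to U; nonzero to U≉0; annihilates to U-annihilates)
  open PrimitiveUnit k k-odd (primitive-exists k k-odd)
  open EvenClasses (congruent-equivalence L k) (congruent? L k)

  Os : List (Orientation L)
  Os = allOrientations L

  Coloring : Set
  Coloring = Fin n → Fin k

  -- g^{weight c o} is the monomial ∏ᵥ x_v^{s⁺(v)} of o evaluated at x_v = g^{c(v)}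
  weight : Coloring → Orientation L → ℕ
  weight c o = ∑[ v < n ] (toℕ (c v) * outdeg L o v)

  orientationSum : Coloring → List ℕ
  orientationSum c = map (weight c) Os

  colorOf : Coloring → Fin (m L) → Bool → ℕ
  colorOf c e b = toℕ (c (if b then proj₁ (ends L e) else proj₂ (ends L e)))

  edgeFactor : Coloring → Fin (m L) → List ℕ
  edgeFactor c e = [ colorOf c e true ] ++ [ colorOf c e false ]

  -- the graph polynomial ∏ₑ (x_a + x_b) evaluated at x_v = g^{c(v)}, expanded over orientations
  orientationSum-expansion : ∀ c → orientationSum c ≈ ∏ (m L) (edgeFactor c)
  orientationSum-expansion c =
    ≈-trans (≡⇒≈ (map-cong (weighted-outdeg L (toℕ ∘ c)) Os)) (choice-expansion (m L) (colorOf c))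

  weight-mod : ∀ c o o′ → Congruent L k o o′ → weight c o % k ≡ weight c o′ % k
  weight-mod c o o′ o∼o′ = ∑-cong-mod k n (λ v → *-congˡ-mod (toℕ (c v)) (o∼o′ v))

  orientationSum-vanishes : (∀ o → o ∈ Os → classSize L k o % 2 ≢ 1) → ∀ c → orientationSum c ≈ []
  orientationSum-vanishes all-even c = by-parity λ P per →
    trans (parity-map P (weight c) Os) (parity-even-classes (P ∘ weight c) (respects P per) Os class-even)
    where
    respects : ∀ P → Periodic P → ∀ o o′ → Congruent L k o o′ → P (weight c o) ≡ P (weight c o′)
    respects P per o o′ o∼o′ =
      trans (per (weight c o)) (trans (cong P (weight-mod c o o′ o∼o′)) (sym (per (weight c o′))))
    class-even : ∀ o → o ∈ Os → EvenClass Os o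
    class-even o o∈Os = trans (sym (isOdd-filter (congruent? L k o) Os)) (isOdd-false (classSize L k o) (all-even o o∈Os))

  -- for a proper colouring every edge factor is invertible on U
  edgeInverse : Coloring → Fin (m L) → List ℕ
  edgeInverse c e = [ k ∸ colorOf c e false % k ] ⊗ oddMultiples half (colorOf c e true ⊖ colorOf c e false)

  proper⇒nonvanishing : ∀ c → ProperColoring L k c → U ⊗ (orientationSum c ⊗ ∏ (m L) (edgeInverse c)) ≈ U
  proper⇒nonvanishing c proper = begin
    U ⊗ (orientationSum c ⊗ ∏ (m L) (edgeInverse c))
      ≈⟨ ⊗-congʳ U (⊗-congˡ (∏ (m L) (edgeInverse c)) (orientationSum-expansion c)) ⟩
    U ⊗ (∏ (m L) (edgeFactor c) ⊗ ∏ (m L) (edgeInverse c))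
      ≈⟨ ⊗-congʳ U (∏-⊗ (m L) (edgeFactor c) (edgeInverse c)) ⟩
    U ⊗ ∏ (m L) (λ e → edgeFactor c e ⊗ edgeInverse c e)
      ≈⟨ ∏-fix U (m L) _ (λ e → pair-unit (colorOf c e true) (colorOf c e false) (distinct e)) ⟩
    U ∎
    where
    open ≈-Reasoning setoid
    distinct : ∀ e → colorOf c e true % k ≢ colorOf c e false % k
    distinct e same = proper e (toℕ-injective (trans (sym (m<n⇒m%n≡m (toℕ<n _))) (trans same (m<n⇒m%n≡m (toℕ<n _)))))

  -- a proper colouring forces an odd class: otherwise U = U·(orientation sum)·(inverses) = 0
  colorable⇒odd-class : Colorable L k → ∃ (λ o → classSize L k o % 2 ≡ 1)
  colorable⇒odd-class (c , proper) with any? (λ o → classSize L k o % 2 ≟ 1) Os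
  ... | yes odd  = satisfied odd
  ... | no  none = ⊥-elim (U≉0 (begin
    U                              ≈⟨ proper⇒nonvanishing c proper ⟨
    U ⊗ (orientationSum c ⊗ I)     ≈⟨ ⊗-congʳ U (⊗-congˡ I (orientationSum-vanishes all-even c)) ⟩
    U ⊗ ([] ⊗ I)                   ≈⟨ ⊗-zeroʳ U ⟩
    []                             ∎))
    where
    open ≈-Reasoning setoid
    I : List ℕ
    I = ∏ (m L) (edgeInverse c)
    all-even : ∀ o → o ∈ Os → classSize L k o % 2 ≢ 1
    all-even o o∈Os odd = none (lose o∈Os odd)

  improper⇒vanishing : ∀ c → ¬ ProperColoring L k c → orientationSum c ≈ []
  improper⇒vanishing c improper =
    let (e , ¬distinct) = ¬∀⟶∃¬ (m L) _ (λ e → ¬? (c (proj₁ (ends L e)) ≟F c (proj₂ (ends L e)))) improper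
        same            = decidable-stable (c (proj₁ (ends L e)) ≟F c (proj₂ (ends L e))) ¬distinct
    in ≈-trans (orientationSum-expansion c) (∏-zero (m L) (edgeFactor c) e (begin
      [ toℕ (c (proj₁ (ends L e))) ] ++ [ toℕ (c (proj₂ (ends L e))) ]
        ≈⟨ ≡⇒≈ (cong (λ x → [ toℕ (c (proj₁ (ends L e))) ] ++ [ toℕ x ]) same) ⟨
      [ toℕ (c (proj₁ (ends L e))) ] ++ [ toℕ (c (proj₁ (ends L e))) ]
        ≈⟨ ++-self [ toℕ (c (proj₁ (ends L e))) ] ⟩
      [] ∎))
    where open ≈-Reasoning setoid

  -- Measuring out-degrees relative to os, the double sum over
  -- colourings c and orientations o of g^{Σᵥ c(v)·(s⁺_o(v) - s⁺_os(v))}, multiplied by U,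
  -- is computed in two ways.
  module Relative (os : Orientation L) where

    relDeg : Orientation L → Fin n → ℕ
    relDeg o v = outdeg L o v ⊖ outdeg L os v

    relWeight : Coloring → Orientation L → ℕ
    relWeight c o = ∑[ v < n ] (toℕ (c v) * relDeg o v)

    shift : Coloring → ℕ
    shift c = ∑[ v < n ] (toℕ (c v) * (k ∸ outdeg L os v % k))

    relWeight-split : ∀ c o → relWeight c o ≡ shift c + weight c o
    relWeight-split c o = begin
      ∑[ v < n ] (toℕ (c v) * relDeg o v)
        ≡⟨ sum-cong-≗ (λ v → *-distribˡ-+ (toℕ (c v)) (outdeg L o v) _) ⟩
      ∑[ v < n ] (toℕ (c v) * outdeg L o v + toℕ (c v) * (k ∸ outdeg L os v % k))
        ≡⟨ ∑-distrib-+ (λ v → toℕ (c v) * outdeg L o v) (λ v → toℕ (c v) * (k ∸ outdeg L os v % k)) ⟩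
      weight c o + shift c
        ≡⟨ +-comm (weight c o) (shift c) ⟩
      shift c + weight c o
        ∎
      where open ≡-Reasoning

    total : List ℕ
    total = U ⊗ concatMap (λ c → map (relWeight c) Os) (colorings n)

    -- Summing over colourings first gives U·∏ᵥ Σ_{j<k} g^{j·relDeg o v}, which is U when o is
    -- congruent to os (all relative degrees vanish) and 0 otherwise (U kills a nontrivial orbit).
    per-orientation : ∀ o → U ⊗ map (λ c → relWeight c o) (colorings n) ≈ (if does (congruent? L k os o) then U else [])
    per-orientation o = ≈-trans (⊗-congʳ U (coloring-expansion n (relDeg o))) (by-congruence (congruent? L k os o))
      where
      by-congruence : (d : Dec (Congruent L k os o)) →
        U ⊗ ∏ n (λ v → multiples k (relDeg o v)) ≈ (if does d then U else [])
      by-congruence (yes os∼o) = ≈-trans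
        (⊗-congʳ U (∏-ones n _ (λ v → multiples-trivial (relDeg o v) (≡⇒⊖≡0 _ _ (sym (os∼o v))))))
        (⊗-identityʳ U)
      by-congruence (no os≁o) =
        let (v , ¬v) = ¬∀⟶∃¬ n _ (λ v → outdeg L os v % k ≟ outdeg L o v % k) os≁o
        in ∏-absorb U n _ v (U-annihilates (relDeg o v) (λ zero → ¬v (sym (⊖≡0⇒≡ _ _ zero))))

    -- orientations first: the terms are U for each o in the class of os
    total≈U : classSize L k os % 2 ≡ 1 → total ≈ U
    total≈U odd = begin
      U ⊗ concatMap (λ c → map (relWeight c) Os) Cs
        ≈⟨ ⊗-congʳ U (concatMap-cong Cs (λ c → map-as-concatMap (relWeight c) Os)) ⟩
      U ⊗ concatMap (λ c → concatMap (λ o → [ relWeight c o ]) Os) Cs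
        ≈⟨ ⊗-congʳ U (concatMap-swap (λ c o → [ relWeight c o ]) Cs Os) ⟩
      U ⊗ concatMap (λ o → concatMap (λ c → [ relWeight c o ]) Cs) Os
        ≈⟨ ⊗-congʳ U (concatMap-cong Os (λ o → map-as-concatMap (λ c → relWeight c o) Cs)) ⟨
      U ⊗ concatMap (λ o → map (λ c → relWeight c o) Cs) Os
        ≈⟨ ⊗-distrib-concatMap U (λ o → map (λ c → relWeight c o) Cs) Os ⟩
      concatMap (λ o → U ⊗ map (λ c → relWeight c o) Cs) Os
        ≈⟨ concatMap-cong Os per-orientation ⟩
      concatMap (λ o → if does (congruent? L k os o) then U else []) Os
        ≈⟨ concatMap-if (does ∘ congruent? L k os) U Os ⟩
      (if parity (does ∘ congruent? L k os) Os then U else [])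
        ≈⟨ ≡⇒≈ (cong (if_then U else []) class-odd) ⟩
      U ∎
      where
      open ≈-Reasoning setoid
      Cs : List Coloring
      Cs = colorings n
      class-odd : parity (does ∘ congruent? L k os) Os ≡ true
      class-odd = trans (sym (isOdd-filter (congruent? L k os) Os)) (isOdd-complete (classSize L k os) odd)

    -- colourings first: each term is g^{shift c}·orientationSum c, which vanishes for improper c
    total≈0 : (∀ c → c ∈ colorings n → ¬ ProperColoring L k c) → total ≈ []
    total≈0 none-proper = ≈-trans (⊗-congʳ U (concatMap-vanishes (colorings n) vanishes)) (⊗-zeroʳ U)
      where
      vanishes : ∀ c → c ∈ colorings n → map (relWeight c) Os ≈ []
      vanishes c c∈Cs = begin
        map (relWeight c) Os                     ≈⟨ ≡⇒≈ (map-cong (relWeight-split c) Os) ⟩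
        map (λ o → shift c + weight c o) Os      ≈⟨ ≡⇒≈ (trans (map-∘ Os) (sym (++-identityʳ _))) ⟩
        [ shift c ] ⊗ orientationSum c           ≈⟨ ⊗-congʳ [ shift c ] (improper⇒vanishing c (none-proper c c∈Cs)) ⟩
        [ shift c ] ⊗ []                         ≈⟨ ⊗-zeroʳ [ shift c ] ⟩
        []                                       ∎
        where open ≈-Reasoning setoid

  -- an odd class forces a proper colouring: otherwise U = total = 0
  odd-class⇒colorable : ∃ (λ o → classSize L k o % 2 ≡ 1) → Colorable L k
  odd-class⇒colorable (os , odd) with any? proper? (colorings n)
    where
    proper? : (c : Coloring) → Dec (ProperColoring L k c)
    proper? c = all? (λ e → ¬? (c (proj₁ (ends L e)) ≟F c (proj₂ (ends L e))))
  ... | yes found = satisfied found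
  ... | no  none  = ⊥-elim (U≉0 (≈-trans (≈-sym (total≈U odd)) (total≈0 (λ c c∈Cs proper → none (lose c∈Cs proper)))))
    where open Relative os

mainTheorem3 : (k : ℕ) → .{{_ : NonZero k}} → k % 2 ≡ 1 →
    ∀ {n} (L : Graph n) →
    Colorable L k ⇔ ∃ (λ (o : Orientation L) → classSize L k o % 2 ≡ 1)
mainTheorem3 k k-odd L = mk⇔ colorable⇒odd-class odd-class⇒colorable
  where open ColoringTheorem k k-odd L
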